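{- Let $G,G_1,G_2$ be digraphs and $i_1\colon G\to G_1$, $i_2\colon G\to G_2$ regular morphisms of digraphs, and let $\mathbb K$ be a field. Then there is a short exact sequence of cochain complexes \[0\to C^*(\nabla_{P(G)}(P(G_1),P(G_2));\mathbb K)\to C^*_\mu(G_1;\mathbb K)\oplus C^*_\mu(G_2;\mathbb K)\to C^*_\mu(G;\mathbb K)\to 0,\] inducing a long exact sequence \[\cdots\to \mathrm{H}^{i-1}_\mu(G;\mathbb K)\to \mathrm{H}^{i}(\nabla_{P(G)}(P(G_1),P(G_2));\mathbb K)\to \mathrm{H}^i_\mu(G_1;\mathbb K)\oplus \mathrm{H}^i_\mu(G_2;\mathbb K)\to \mathrm{H}^i_\mu(G;\mathbb K)\to\cdots.\]
   Context: Digraph: finite vertex set $V$, edges $E\subseteq (V\times V)\setminus\{(v,v)\}$. A morphism of digraphs $G\to G'$ is a map $\phi\colon V(G)\to V(G')$ with $(\phi(v),\phi(w))\in E(G')$ whenever $(v,w)\in E(G)$; it is regular if injective. A multipath of $G$ is a spanning subgraph each of whose connected components is a single vertex or a simple directed path (no repeated vertex, not a cycle); $P(G)$ is the poset of multipaths ordered by inclusion. A regular morphism $G\to G_j$ induces an injective poset map $P(G)\to P(G_j)$ (send a multipath to the spanning subgraph of $G_j$ with the image edges), identifying $P(G)$ with a subposet of $P(G_j)$. The gluing $\nabla_{P(G)}(P(G_1),P(G_2))$ is the poset whose Hasse diagram is obtained from the Hasse diagrams of $P(G_1)$ and $P(G_2)$ by identifying the two copies of the Hasse diagram of $P(G)$.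 A sign assignment on a poset is a function $\epsilon$ from covering pairs to $\mathbb Z/2$ with $\epsilon(x,y)+\epsilon(y,z)\equiv\epsilon(x,y')+\epsilon(y',z)+1\pmod 2$ for each square $x\prec y,y'\prec z$. For a finite poset $P$ with minimum and a sign assignment, $C^*(P;\mathbb K)$ has in degree $n$ basis the elements $x$ of level $n$ (minimal number of coverings from the minimum to $x$) and differential $d b_x=\sum_{x\prec y}(-1)^{\epsilon(x,y)}b_y$; $\mathrm{H}^*(P;\mathbb K)$ is its cohomology. Multipath cohomology: $C^*_\mu(G;\mathbb K)=C^*(P(G);\mathbb K)$ (level = number of edges) and $\mathrm{H}^*_\mu(G;\mathbb K)$ its cohomology, independent of the sign assignment. -}

module Defs where

open import Level using (Level; _⊔_) renaming (suc to lsuc)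
open import Data.Nat using (ℕ; zero; suc) renaming (_+_ to _+ℕ_)
open import Data.Fin using (Fin; _≟_)
import Data.Fin as Fin
import Data.Bool
open import Data.Bool using (Bool; true; false; T; _∧_; _∨_; not; if_then_else_; _xor_)
open import Data.Vec using (Vec; lookup; tabulate)
import Data.Vec as Vec
open import Data.Vec.Properties using (lookup∘tabulate; tabulate∘lookup; tabulate-cong)
import Data.Vec.Properties as VecP
open import Data.List using (List; []; _∷_; map; foldr; filterᵇ; cartesianProduct; allFin)
open import Data.List.Membership.Propositional using (_∈_)
open import Data.Product using (Σ; ∃; _×_; _,_; proj₁; proj₂)
open import Data.Sum using (_⊎_; inj₁; inj₂)
open import Data.Empty using (⊥; ⊥-elim; ⊥-elim-irr)
open import Data.Unit using (tt)
open import Function using (_∘_)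
open import Function.Definitions using (Injective)
open import Relation.Nullary using (¬_; Dec; yes; no; does)
open import Relation.Nullary.Decidable using (toWitness; fromWitness; ⌊_⌋)
open import Relation.Binary.PropositionalEquality
  using (_≡_; _≢_; refl; sym; trans; cong; subst)
open import Relation.Binary.Construct.Closure.Transitive using (TransClosure; [_]; _∷_)
open import Algebra.Bundles using (CommutativeRing)

T→≡true : ∀ {b} → T b → b ≡ true
T→≡true {true} _ = refl

¬T→≡false : ∀ {b} → ¬ T b → b ≡ false
¬T→≡false {true} h = ⊥-elim (h tt)
¬T→≡false {false} _ = refl

contra : ∀ {b} → b ≡ false → T b → ⊥
contra refl ()

∧-true : ∀ x y → .(T x) → T y → x ∧ y ≡ true
∧-true true y _ h = T→≡true h
∧-true false y () h

∧-l : ∀ {a b} → T (a ∧ b) → T a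
∧-l {true} _ = tt

∧-r : ∀ {a b} → T (a ∧ b) → T b
∧-r {true} p = p

∧-i : ∀ {a b} → T a → T b → T (a ∧ b)
∧-i {true} _ q = q

existsᵇ : ∀ {m} → (Fin m → Bool) → Bool
existsᵇ {zero} p = false
existsᵇ {suc m} p = p Fin.zero ∨ existsᵇ (p ∘ Fin.suc)

existsᵇ-elim : ∀ {m} (p : Fin m → Bool) → T (existsᵇ p) → ∃ λ a → T (p a)
existsᵇ-elim {suc m} p h with p Fin.zero in eq
... | true = Fin.zero , subst T (sym eq) tt
... | false with existsᵇ-elim (p ∘ Fin.suc) h
...   | a , q = Fin.suc a , q

existsᵇ-intro : ∀ {m} (p : Fin m → Bool) (a : Fin m) → T (p a) → T (existsᵇ p)
existsᵇ-intro p Fin.zero h with p Fin.zero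
... | true = tt
existsᵇ-intro p (Fin.suc a) h with p Fin.zero
... | true = tt
... | false = existsᵇ-intro (p ∘ Fin.suc) a h

_==_ : ∀ {n} → Fin n → Fin n → Bool
a == b = ⌊ a ≟ b ⌋

record Digraph : Set where
  field
    size     : ℕ
    edge     : Fin size → Fin size → Bool
    loopless : ∀ v → edge v v ≡ false
open Digraph public

record RegularMorphism (G H : Digraph) : Set where
  field
    vmap      : Fin (size G) → Fin (size H)
    preserves : ∀ v w → T (edge G v w) → T (edge H (vmap v) (vmap w))
    injective : Injective _≡_ _≡_ vmap
open RegularMorphism public

Matrix : ℕ → Set
Matrix n = Vec (Vec Bool n) n

at : ∀ {n} → Matrix n → Fin n → Fin n → Bool
at M u v = lookup (lookup M u) v

mkMatrix : ∀ {n} → (Fin n → Fin n → Bool) → Matrix n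
mkMatrix f = tabulate λ u → tabulate λ v → f u v

at-mk : ∀ {n} (f : Fin n → Fin n → Bool) u v → at (mkMatrix f) u v ≡ f u v
at-mk f u v rewrite lookup∘tabulate (λ u → tabulate λ v → f u v) u
  = lookup∘tabulate (f u) v

matrix-ext : ∀ {n} {M N : Matrix n} → (∀ u v → at M u v ≡ at N u v) → M ≡ N
matrix-ext {M = M} {N} h =
  trans (sym (tabulate∘lookup M))
   (trans (tabulate-cong (λ u → trans (sym (tabulate∘lookup (lookup M u)))
                              (trans (tabulate-cong (h u)) (tabulate∘lookup (lookup N u)))))
          (tabulate∘lookup N))

Edge : ∀ {n} → Matrix n → Fin n → Fin n → Set
Edge M u v = T (at M u v)

-- A spanning subgraph S of G is a multipath iff every connected component
-- is a single vertex or a simple directed path, i.e. iff S ⊆ E(G), every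
-- vertex has out-degree ≤ 1 and in-degree ≤ 1 in S, and S has no directed
-- cycle (no vertex v with a nonempty directed walk from v to v).
record IsMultipath (G : Digraph) (S : Matrix (size G)) : Set where
  field
    sub     : ∀ u v → Edge S u v → T (edge G u v)
    outDeg  : ∀ u v w → Edge S u v → Edge S u w → v ≡ w
    inDeg   : ∀ u v w → Edge S v u → Edge S w u → v ≡ w
    acyclic : ∀ v → ¬ TransClosure (Edge S) v v
open IsMultipath public

record Multipath (G : Digraph) : Set where
  constructor mp
  field
    edges        : Matrix (size G)
    .isMultipath : IsMultipath G edges
open Multipath public

mp-ext : ∀ {G} {x y : Multipath G} → edges x ≡ edges y → x ≡ y
mp-ext refl = refl

countRow : ∀ {n} → Vec Bool n → ℕ
countRow = Vec.foldr _ (λ b k → (if b then 1 else 0) +ℕ k) 0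

#edges : ∀ {n} → Matrix n → ℕ
#edges = Vec.foldr _ (λ row k → countRow row +ℕ k) 0

removeM : ∀ {n} → Matrix n → Fin n → Fin n → Matrix n
removeM M u v = mkMatrix λ a b → at M a b ∧ not ((a == u) ∧ (b == v))

removeM-⊆ : ∀ {n} (M : Matrix n) u v a b → Edge (removeM M u v) a b → Edge M a b
removeM-⊆ M u v a b h = ∧-l (subst T (at-mk _ a b) h)

closure-mono : ∀ {n} {R S : Fin n → Fin n → Set} → (∀ a b → R a b → S a b) →
               ∀ {a b} → TransClosure R a b → TransClosure S a b
closure-mono f [ r ] = [ f _ _ r ]
closure-mono f (r ∷ rs) = f _ _ r ∷ closure-mono f rs

removeM-isMP : ∀ {G} (S : Matrix (size G)) u v → IsMultipath G S →
               IsMultipath G (removeM S u v)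
removeM-isMP S u v p = record
  { sub = λ a b h → sub p a b (⊆ a b h)
  ; outDeg = λ a b c h k → outDeg p a b c (⊆ a b h) (⊆ a c k)
  ; inDeg = λ a b c h k → inDeg p a b c (⊆ b a h) (⊆ c a k)
  ; acyclic = λ a c → acyclic p a (closure-mono ⊆ c)
  }
  where ⊆ = removeM-⊆ S u v

allPairs : ∀ n → List (Fin n × Fin n)
allPairs n = cartesianProduct (allFin n) (allFin n)

removeMP : ∀ {G} → Multipath G → Fin (size G) × Fin (size G) → Multipath G
removeMP (mp S p) (u , v) = mp (removeM S u v) (removeM-isMP S u v p)

predsP : ∀ {G} → Multipath G → List (Multipath G)
predsP {G} x = map (removeMP x) (filterᵇ (λ e → at (edges x) (proj₁ e) (proj₂ e)) (allPairs (size G)))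

imgM : ∀ {G H} → RegularMorphism G H → Matrix (size G) → Matrix (size H)
imgM i S = mkMatrix λ u v →
  existsᵇ λ a → existsᵇ λ b → at S a b ∧ ((vmap i a == u) ∧ (vmap i b == v))

module _ {G H : Digraph} (i : RegularMorphism G H) (S : Matrix (size G)) where
  private f = vmap i

  imgM-elim : ∀ u v → Edge (imgM i S) u v →
              Σ (Fin (size G)) λ a → Σ (Fin (size G)) λ b → Edge S a b × f a ≡ u × f b ≡ v
  imgM-elim u v h with existsᵇ-elim _ (subst T (at-mk _ u v) h)
  ... | a , h1 with existsᵇ-elim _ h1
  ...   | b , h2 = a , b , ∧-l {at S a b} h2 ,
                   toWitness {a? = f a ≟ u} (∧-l {f a == u} {f b == v} (∧-r {at S a b} h2)) ,
                   toWitness {a? = f b ≟ v} (∧-r {f a == u} {f b == v} (∧-r {at S a b} h2))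

  imgM-intro : ∀ a b → Edge S a b → Edge (imgM i S) (f a) (f b)
  imgM-intro a b h = subst T (sym (at-mk _ (f a) (f b)))
    (existsᵇ-intro _ a (existsᵇ-intro _ b (∧-i {at S a b} h (∧-i {f a == f a} {f b == f b}
        (fromWitness {a? = f a ≟ f a} refl) (fromWitness {a? = f b ≟ f b} refl)))))

  private
    lift : ∀ {u v} → TransClosure (Edge (imgM i S)) u v →
           Σ (Fin (size G)) λ a → Σ (Fin (size G)) λ b → f a ≡ u × f b ≡ v × TransClosure (Edge S) a b
    lift {u} {v} [ h ] with imgM-elim u v h
    ... | a , b , e , p , q = a , b , p , q , [ e ]
    lift {u} (h ∷ hs) with imgM-elim u _ h | lift hs
    ... | a , b , e , p , q | a' , b' , p' , q' , r
      with injective i (trans q (sym p'))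
    ... | refl = a , b' , p , q' , (e ∷ r)

  imgM-isMP : IsMultipath G S → IsMultipath H (imgM i S)
  imgM-isMP m = record
    { sub = λ u v h → case-sub u v (imgM-elim u v h)
    ; outDeg = λ u v w h k → case-out (imgM-elim u v h) (imgM-elim u w k)
    ; inDeg = λ u v w h k → case-in (imgM-elim v u h) (imgM-elim w u k)
    ; acyclic = λ v c → case-acyc (lift c)
    }
    where
    case-sub : ∀ u v → (Σ (Fin (size G)) λ a → Σ (Fin (size G)) λ b → Edge S a b × f a ≡ u × f b ≡ v) → T (edge H u v)
    case-sub _ _ (a , b , e , refl , refl) = preserves i a b (sub m a b e)
    case-out : ∀ {u v w} → (Σ (Fin (size G)) λ a → Σ (Fin (size G)) λ b → Edge S a b × f a ≡ u × f b ≡ v)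
                       → (Σ (Fin (size G)) λ a → Σ (Fin (size G)) λ b → Edge S a b × f a ≡ u × f b ≡ w) → v ≡ w
    case-out (a , b , e , refl , refl) (a' , b' , e' , p , refl) with injective i p
    ... | refl = cong f (outDeg m a b b' e e')
    case-in : ∀ {u v w} → (Σ (Fin (size G)) λ a → Σ (Fin (size G)) λ b → Edge S a b × f a ≡ v × f b ≡ u)
                       → (Σ (Fin (size G)) λ a → Σ (Fin (size G)) λ b → Edge S a b × f a ≡ w × f b ≡ u) → v ≡ w
    case-in (a , b , e , refl , refl) (a' , b' , e' , refl , q) with injective i q
    ... | refl = cong f (inDeg m b a a' e e')
    case-acyc : ∀ {v} → (Σ (Fin (size G)) λ a → Σ (Fin (size G)) λ b → f a ≡ v × f b ≡ v × TransClosure (Edge S) a b) → ⊥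
    case-acyc (a , b , p , q , r) with injective i (trans p (sym q))
    ... | refl = acyclic m a r

ι : ∀ {G H} → RegularMorphism G H → Multipath G → Multipath H
ι i (mp S p) = mp (imgM i S) (imgM-isMP i S p)

preM : ∀ {G H} → RegularMorphism G H → Matrix (size H) → Matrix (size G)
preM {G} i Z = mkMatrix λ a b → edge G a b ∧ at Z (vmap i a) (vmap i b)

module _ {G H : Digraph} (i : RegularMorphism G H) (Z : Matrix (size H)) where
  private
    f = vmap i
    ⊆ : ∀ a b → Edge (preM i Z) a b → Edge Z (f a) (f b)
    ⊆ a b h = ∧-r (subst T (at-mk _ a b) h)

  preM-isMP : IsMultipath H Z → IsMultipath G (preM i Z)
  preM-isMP m = record
    { sub = λ a b h → ∧-l (subst T (at-mk _ a b) h)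
    ; outDeg = λ a b c h k → injective i (outDeg m (f a) (f b) (f c) (⊆ a b h) (⊆ a c k))
    ; inDeg = λ a b c h k → injective i (inDeg m (f a) (f b) (f c) (⊆ b a h) (⊆ c a k))
    ; acyclic = λ a c → acyclic m (f a) (go c)
    }
    where
    go : ∀ {a b} → TransClosure (Edge (preM i Z)) a b → TransClosure (Edge Z) (f a) (f b)
    go [ h ] = [ ⊆ _ _ h ]
    go (h ∷ hs) = ⊆ _ _ h ∷ go hs

preMP : ∀ {G H} → RegularMorphism G H → Multipath H → Multipath G
preMP i (mp Z p) = mp (preM i Z) (preM-isMP i Z p)

pre∘img : ∀ {G H} (i : RegularMorphism G H) (x : Multipath G) → preMP i (ι i x) ≡ x
pre∘img {G} i (mp S p) = mp-ext (matrix-ext pt)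
  where
  pt : ∀ a b → at (preM i (imgM i S)) a b ≡ at S a b
  pt a b rewrite at-mk (λ a b → edge G a b ∧ at (imgM i S) (vmap i a) (vmap i b)) a b
    with at S a b in eq
  ... | true = ∧-true _ _ (sub p a b (subst T (sym eq) tt))
                 (imgM-intro i S a b (subst T (sym eq) tt))
  ... | false = ¬T→≡false λ h → absurd i S a b eq (imgM-elim i S _ _ (∧-r h))
    where
    absurd : ∀ {G H} (i : RegularMorphism G H) (S : Matrix (size G)) a b → at S a b ≡ false →
             (Σ (Fin (size G)) λ a' → Σ (Fin (size G)) λ b' →
              Edge S a' b' × vmap i a' ≡ vmap i a × vmap i b' ≡ vmap i b) → ⊥
    absurd i S a b eq (a' , b' , e , q , r) with injective i q | injective i r
    ... | refl | refl = contra eq e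

InImage : ∀ {G H} → RegularMorphism G H → Multipath H → Set
InImage {G} i z = Σ (Multipath G) λ x → ι i x ≡ z

inImage? : ∀ {G H} (i : RegularMorphism G H) (z : Multipath H) → Dec (InImage i z)
inImage? i z with VecP.≡-dec (VecP.≡-dec Data.Bool._≟_) (edges (ι i (preMP i z))) (edges z)
... | yes eq = yes (preMP i z , mp-ext eq)
... | no neq = no λ { (x , refl) → neq (cong (λ y → edges (ι i y)) (pre∘img i x)) }

-- Finite posets presented by their Hasse diagram: for each element the
-- list of the elements it covers, together with its level.

record Hasse : Set₁ where
  field
    Elt   : Set
    preds : Elt → List Elt
    level : Elt → ℕ
open Hasse public

Covers : (P : Hasse) → Elt P → Elt P → Set
Covers P x y = x ∈ preds P y

-- A sign assignment: a Z/2-valued function (Bool, addition = xor) on pairs,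
-- of which only the values on covering pairs matter, such that
-- ε(x,y)+ε(y,z) ≡ ε(x,y')+ε(y',z)+1 for every square x≺y,y'≺z (y ≠ y').
IsSignAssignment : (P : Hasse) → (Elt P → Elt P → Bool) → Set
IsSignAssignment P ε =
  ∀ {x y y' z} → y ≢ y' → Covers P x y → Covers P x y' → Covers P y z → Covers P y' z →
  (ε x y xor ε y z) ≡ not (ε x y' xor ε y' z)

record SignAssignment (P : Hasse) : Set where
  field
    sign     : Elt P → Elt P → Bool
    isSign   : IsSignAssignment P sign
open SignAssignment public

record Signed : Set₁ where
  field
    poset : Hasse
    ε     : Elt poset → Elt poset → Bool
open Signed public

signed : (P : Hasse) → SignAssignment P → Signed
signed P s = record { poset = P ; ε = sign s }

-- direct sum (disjoint union) of signed posets; its cochain complex is the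
-- direct sum of the cochain complexes
_⊕_ : Signed → Signed → Signed
X ⊕ Y = record
  { poset = record
    { Elt = Elt (poset X) ⊎ Elt (poset Y)
    ; preds = λ { (inj₁ a) → map inj₁ (preds (poset X) a) ; (inj₂ b) → map inj₂ (preds (poset Y) b) }
    ; level = λ { (inj₁ a) → level (poset X) a ; (inj₂ b) → level (poset Y) b }
    }
  ; ε = λ { (inj₁ a) (inj₁ b) → ε X a b ; (inj₂ a) (inj₂ b) → ε Y a b ; _ _ → false }
  }

P : Digraph → Hasse
P G = record { Elt = Multipath G ; preds = predsP ; level = λ x → #edges (edges x) }

-- Elements: the elements of P(G₁), and the elements of P(G₂) not in the
-- image of P(G) (those are identified with elements of P(G₁) via i₁).

data Elt∇ {G G₁ G₂ : Digraph} (i₁ : RegularMorphism G G₁) (i₂ : RegularMorphism G G₂) : Set where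
  left  : Multipath G₁ → Elt∇ i₁ i₂
  right : (z : Multipath G₂) → .(¬ InImage i₂ z) → Elt∇ i₁ i₂

module _ {G G₁ G₂ : Digraph} (i₁ : RegularMorphism G G₁) (i₂ : RegularMorphism G G₂) where

  class₂ : Multipath G₂ → Elt∇ i₁ i₂
  class₂ z with inImage? i₂ z
  ... | yes (x , _) = left (ι i₁ x)
  ... | no n = right z n

  preds∇ : Elt∇ i₁ i₂ → List (Elt∇ i₁ i₂)
  preds∇ (left x) = map left (predsP x)
  preds∇ (right z _) = map class₂ (predsP z)

  level∇ : Elt∇ i₁ i₂ → ℕ
  level∇ (left x) = #edges (edges x)
  level∇ (right z _) = #edges (edges z)

  ∇ : Hasse
  ∇ = record { Elt = Elt∇ i₁ i₂ ; preds = preds∇ ; level = level∇ }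

record Field (c ℓ : Level) : Set (lsuc (c ⊔ ℓ)) where
  field
    commutativeRing : CommutativeRing c ℓ
  open CommutativeRing commutativeRing public
  field
    0≉1     : ¬ (0# ≈ 1#)
    inverse : ∀ x → ¬ (x ≈ 0#) → ∃ λ y → (x * y) ≈ 1#

-- The cochain complex C^*(P;K) of a signed poset, with cochains in degree n
-- represented as functions Elt → K of which only the values on elements of
-- level n matter (equality _≈[ n ]_ compares them on level n only).
-- d b_x = Σ_{x≺y} (-1)^{ε(x,y)} b_y, i.e. (d f)(y) = Σ_{x≺y} (-1)^{ε(x,y)} f(x).

module Cochains {c ℓ} (K : Field c ℓ) where
  open Field K

  Cochain : Signed → Set c
  Cochain X = Elt (poset X) → Carrier

  Eq : (X : Signed) → ℕ → Cochain X → Cochain X → Set ℓ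
  Eq X n f g = ∀ x → level (poset X) x ≡ n → f x ≈ g x

  sgn : Bool → Carrier
  sgn true = - 1#
  sgn false = 1#

  sumK : List Carrier → Carrier
  sumK = foldr _+_ 0#

  d : (X : Signed) → Cochain X → Cochain X
  d X f y = sumK (map (λ x → sgn (ε X x y) * f x) (preds (poset X) y))

  0c : ∀ {E : Set} → E → Carrier
  0c _ = 0#

  _+c_ : ∀ {E : Set} → (E → Carrier) → (E → Carrier) → E → Carrier
  (f +c g) x = f x + g x

  _-c_ : ∀ {E : Set} → (E → Carrier) → (E → Carrier) → E → Carrier
  (f -c g) x = f x - g x

  _·c_ : ∀ {E : Set} → Carrier → (E → Carrier) → E → Carrier
  (a ·c f) x = a * f x

  record CochainMap (X Y : Signed) : Set (c ⊔ ℓ) where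
    field
      fun   : ℕ → Cochain X → Cochain Y
      resp  : ∀ n {f g} → Eq X n f g → Eq Y n (fun n f) (fun n g)
      +-hom : ∀ n f g → Eq Y n (fun n (f +c g)) (fun n f +c fun n g)
      ·-hom : ∀ n a f → Eq Y n (fun n (a ·c f)) (a ·c fun n f)
      comm  : ∀ n f → Eq Y (suc n) (d Y (fun n f)) (fun (suc n) (d X f))
  open CochainMap public

  record ShortExact {A B C : Signed} (F : CochainMap A B) (G : CochainMap B C) : Set (c ⊔ ℓ) where
    field
      F-inj  : ∀ n f → Eq B n (fun F n f) 0c → Eq A n f 0c
      GF≈0   : ∀ n f → Eq C n (fun G n (fun F n f)) 0c
      kerG⊆imF : ∀ n g → Eq C n (fun G n g) 0c → ∃ λ f → Eq B n (fun F n f) g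
      G-surj : ∀ n h → ∃ λ g → Eq C n (fun G n g) h

  IsCocycle : (X : Signed) → ℕ → Cochain X → Set ℓ
  IsCocycle X n z = Eq X (suc n) (d X z) 0c

  Cohomologous : (X : Signed) → ℕ → Cochain X → Cochain X → Set (c ⊔ ℓ)
  Cohomologous X n z w = ∃ λ h → Eq X n (z -c w) (d X h)

  -- The long exact sequence
  --  0 → H^0(A) → H^0(B) → H^0(C) →δ H^1(A) → … → H^{n}(C) →δ H^{n+1}(A) → H^{n+1}(B) → …
  -- with the maps on cohomology induced by F and G and a linear connecting map δ.
  record LongExact {A B C : Signed} (F : CochainMap A B) (G : CochainMap B C)
                   (δ : ℕ → Cochain C → Cochain A) : Set (c ⊔ ℓ) where
    field
      δ-cocycle : ∀ n z → IsCocycle C n z → IsCocycle A (suc n) (δ n z)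
      δ-resp    : ∀ n z w → IsCocycle C n z → IsCocycle C n w →
                  Cohomologous C n z w → Cohomologous A (suc n) (δ n z) (δ n w)
      δ-+       : ∀ n z w → IsCocycle C n z → IsCocycle C n w →
                  Cohomologous A (suc n) (δ n (z +c w)) (δ n z +c δ n w)
      δ-·       : ∀ n a z → IsCocycle C n z →
                  Cohomologous A (suc n) (δ n (a ·c z)) (a ·c δ n z)
      exact-A₀  : ∀ z → IsCocycle A 0 z → Cohomologous B 0 (fun F 0 z) 0c → Cohomologous A 0 z 0c
      exact-A   : ∀ n z → IsCocycle A (suc n) z →
                  (Cohomologous B (suc n) (fun F (suc n) z) 0c →
                     ∃ λ w → IsCocycle C n w × Cohomologous A (suc n) (δ n w) z)
                  × ((∃ λ w → IsCocycle C n w × Cohomologous A (suc n) (δ n w) z) →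
                     Cohomologous B (suc n) (fun F (suc n) z) 0c)
      exact-B   : ∀ n z → IsCocycle B n z →
                  (Cohomologous C n (fun G n z) 0c →
                     ∃ λ w → IsCocycle A n w × Cohomologous B n (fun F n w) z)
                  × ((∃ λ w → IsCocycle A n w × Cohomologous B n (fun F n w) z) →
                     Cohomologous C n (fun G n z) 0c)
      exact-C   : ∀ n z → IsCocycle C n z →
                  (Cohomologous A (suc n) (δ n z) 0c →
                     ∃ λ w → IsCocycle B n w × Cohomologous C n (fun G n w) z)
                  × ((∃ λ w → IsCocycle B n w × Cohomologous C n (fun G n w) z) →
                     Cohomologous A (suc n) (δ n z) 0c)

module Submission where

open import Defs
open import Data.Nat using (ℕ)
open import Data.Product using (Σ; _×_; _,_)

-- The four cochain complexes only depend on their sign assignments up to a diagonal change of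
-- basis: on the cube-like poset P(G) the sum of two sign assignments (one of them possibly
-- transported along a cover-preserving injection) is a closed Z/2-valued 1-cochain on the
-- Hasse diagram, hence the coboundary of a gauge g, and multiplying cochains by (-1)^g
-- intertwines the two differentials.  With such gauges, restriction to the two copies of
-- P(G₁) and P(G₂) inside the gluing gives a cochain map F, and the difference of the
-- restrictions along i₁ and i₂ gives Φ.  In every degree 0 → C(∇) → C(G₁) ⊕ C(G₂) → C(G) → 0
-- is exact with explicit splittings r (restriction back to ∇) and s (extension by zero along
-- i₁), because ∇ consists of P(G₁) together with the elements of P(G₂) outside the image of
-- P(G).  The connecting map is δ z = r (d (s z)), and the snake lemma gives the long exact
-- sequence.

module Multipaths where
  open import Data.Nat using (ℕ; suc; _+_)
  open import Data.Fin using (Fin; _≟_) renaming (zero to fz; suc to fs)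
  open import Data.Bool using (Bool; true; false; T; _∧_; not)
  open import Data.Bool.Properties using (T?; ∧-zeroʳ; ∧-identityʳ; ∧-commutativeMonoid)
  open import Algebra.Bundles using (CommutativeMonoid)
  open import Algebra.Properties.CommutativeSemigroup
    (CommutativeMonoid.commutativeSemigroup ∧-commutativeMonoid) using (xy∙z≈xz∙y)
  import Data.Vec as Vec
  open import Data.Vec using (Vec; lookup; _∷_; [])
  open import Data.List as List using (List; _∷_; map; filterᵇ; length; cartesianProduct; _++_)
  open import Data.List.Properties using (filter-++; length-++; map-tabulate; length-map; map-cong; map-∘)
  open import Data.List.Membership.Propositional using (_∈_; _∉_)
  open import Data.List.Membership.Propositional.Properties
    using (∈-map⁺; ∈-map⁻; ∈-filter⁺; ∈-filter⁻; ∈-cartesianProduct⁺; ∈-allFin)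
  open import Data.List.Membership.Propositional.Properties.WithK using (unique∧set⇒bag)
  open import Data.List.Relation.Unary.Unique.Propositional using (Unique; _∷_)
  import Data.List.Relation.Unary.Unique.Propositional.Properties as Unique
  open import Data.List.Relation.Unary.Any using (here; there)
  open import Data.List.Relation.Unary.All.Properties using (¬Any⇒All¬)
  open import Data.List.Relation.Binary.BagAndSetEquality using (∼bag⇒↭)
  open import Data.List.Relation.Binary.Permutation.Propositional
    using (_↭_; ↭-sym; module PermutationReasoning)
  import Data.List.Relation.Binary.Permutation.Propositional.Properties as ↭
  open import Data.Product using (∃; proj₁; proj₂)
  open import Data.Product.Properties using (≡-dec)
  import Data.Product as Product
  open import Data.Empty using (⊥-elim)
  open import Data.Unit using (tt)
  open import Function using (_∘_; _⇔_; mk⇔)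
  open import Relation.Nullary using (Dec; yes; no)
  open import Relation.Binary.PropositionalEquality
    using (_≡_; _≢_; refl; sym; trans; cong; cong₂; subst; module ≡-Reasoning)

  Pair : ℕ → Set
  Pair n = Fin n × Fin n

  hasEdge : ∀ {n} → Matrix n → Pair n → Bool
  hasEdge M e = at M (proj₁ e) (proj₂ e)

  edgeList : ∀ {n} → Matrix n → List (Pair n)
  edgeList {n} M = filterᵇ (hasEdge M) (allPairs n)

  ∈-allPairs : ∀ {n} (e : Pair n) → e ∈ allPairs n
  ∈-allPairs (u , v) = ∈-cartesianProduct⁺ (∈-allFin u) (∈-allFin v)

  ∈-edgeList⁺ : ∀ {n} (M : Matrix n) {e} → T (hasEdge M e) → e ∈ edgeList M
  ∈-edgeList⁺ M {e} = ∈-filter⁺ (T? ∘ hasEdge M) (∈-allPairs e)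

  ∈-edgeList⁻ : ∀ {n} (M : Matrix n) {e} → e ∈ edgeList M → T (hasEdge M e)
  ∈-edgeList⁻ {n} M = proj₂ ∘ ∈-filter⁻ (T? ∘ hasEdge M) {xs = allPairs n}

  edgeList-unique : ∀ {n} (M : Matrix n) → Unique (edgeList M)
  edgeList-unique {n} M = Unique.filter⁺ (T? ∘ hasEdge M)
    (Unique.cartesianProduct⁺ (Unique.allFin⁺ n) (Unique.allFin⁺ n))

  unique-sameMembers⇒↭ : ∀ {a} {A : Set a} {xs ys : List A} → Unique xs → Unique ys →
                          (∀ {x} → x ∈ xs ⇔ x ∈ ys) → xs ↭ ys
  unique-sameMembers⇒↭ ux uy same = ∼bag⇒↭ (unique∧set⇒bag ux uy same)

  countRow≡length-filter : ∀ {n} (row : Vec Bool n) {X : Set} (h : Fin n → X) (p : X → Bool) →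
    (∀ v → p (h v) ≡ lookup row v) → countRow row ≡ length (filterᵇ p (List.tabulate h))
  countRow≡length-filter [] h p agree = refl
  countRow≡length-filter (b ∷ row) h p agree with p (h fz) | agree fz
  ... | true  | refl = cong suc (countRow≡length-filter row (h ∘ fs) p (agree ∘ fs))
  ... | false | refl = countRow≡length-filter row (h ∘ fs) p (agree ∘ fs)

  rowSum≡length-filter : ∀ {m n} (M : Vec (Vec Bool n) m) {X Y : Set}
    (g : Fin m → X) (h : Fin n → Y) (p : X × Y → Bool) →
    (∀ u v → p (g u , h v) ≡ lookup (lookup M u) v) →
    Vec.foldr (λ _ → ℕ) (λ row k → countRow row + k) 0 M
      ≡ length (filterᵇ p (cartesianProduct (List.tabulate g) (List.tabulate h)))
  rowSum≡length-filter [] g h p agree = refl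
  rowSum≡length-filter (row ∷ M) {X} {Y} g h p agree = begin
    countRow row + _
      ≡⟨ cong₂ _+_ (countRow≡length-filter row ((g fz ,_) ∘ h) p (agree fz))
                   (rowSum≡length-filter M (g ∘ fs) h p (agree ∘ fs)) ⟩
    length (filterᵇ p (List.tabulate ((g fz ,_) ∘ h))) + length (filterᵇ p rest)
      ≡⟨ cong (λ xs → length (filterᵇ p xs) + length (filterᵇ p rest)) (sym (map-tabulate h (g fz ,_))) ⟩
    length (filterᵇ p (map (g fz ,_) (List.tabulate h))) + length (filterᵇ p rest)
      ≡⟨ sym (length-++ (filterᵇ p (map (g fz ,_) (List.tabulate h)))) ⟩
    length (filterᵇ p (map (g fz ,_) (List.tabulate h)) ++ filterᵇ p rest)
      ≡⟨ cong length (sym (filter-++ (T? ∘ p) (map (g fz ,_) (List.tabulate h)) rest)) ⟩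
    length (filterᵇ p (map (g fz ,_) (List.tabulate h) ++ rest)) ∎
    where
    open ≡-Reasoning
    rest : List (X × Y)
    rest = cartesianProduct (List.tabulate (g ∘ fs)) (List.tabulate h)

  #edges≡length-edgeList : ∀ {n} (M : Matrix n) → #edges M ≡ length (edgeList M)
  #edges≡length-edgeList M = rowSum≡length-filter M (λ u → u) (λ v → v) (hasEdge M) (λ u v → refl)

  removeEdge : ∀ {n} → Matrix n → Pair n → Matrix n
  removeEdge M e = removeM M (proj₁ e) (proj₂ e)

  hasEdge-removeEdge : ∀ {n} (M : Matrix n) e p →
                       hasEdge (removeEdge M e) p ≡ hasEdge M p ∧ not ((proj₁ p == proj₁ e) ∧ (proj₂ p == proj₂ e))
  hasEdge-removeEdge M e p = at-mk _ (proj₁ p) (proj₂ p)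

  hasEdge-removeEdge-self : ∀ {n} (M : Matrix n) e → hasEdge (removeEdge M e) e ≡ false
  hasEdge-removeEdge-self M e rewrite hasEdge-removeEdge M e e with proj₁ e ≟ proj₁ e | proj₂ e ≟ proj₂ e
  ... | yes _ | yes _ = ∧-zeroʳ (hasEdge M e)
  ... | no ne | _     = ⊥-elim (ne refl)
  ... | _     | no ne = ⊥-elim (ne refl)

  hasEdge-removeEdge-other : ∀ {n} (M : Matrix n) {e p} → p ≢ e → hasEdge (removeEdge M e) p ≡ hasEdge M p
  hasEdge-removeEdge-other M {e} {p} p≢e rewrite hasEdge-removeEdge M e p with proj₁ p ≟ proj₁ e | proj₂ p ≟ proj₂ e
  ... | yes r₁ | yes r₂ = ⊥-elim (p≢e (cong₂ _,_ r₁ r₂))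
  ... | yes _  | no _   = ∧-identityʳ (hasEdge M p)
  ... | no _   | _      = ∧-identityʳ (hasEdge M p)

  hasEdge-removeEdge⁻ : ∀ {n} (M : Matrix n) e p → T (hasEdge (removeEdge M e) p) → T (hasEdge M p)
  hasEdge-removeEdge⁻ M e p = removeM-⊆ M (proj₁ e) (proj₂ e) (proj₁ p) (proj₂ p)

  _≟ₚ_ : ∀ {n} (p q : Pair n) → Dec (p ≡ q)
  _≟ₚ_ = ≡-dec _≟_ _≟_

  edgeList-removeEdge : ∀ {n} (M : Matrix n) {e} → T (hasEdge M e) →
                        edgeList M ↭ e ∷ edgeList (removeEdge M e)
  edgeList-removeEdge M {e} he = unique-sameMembers⇒↭ (edgeList-unique M)
    (¬Any⇒All¬ _ e∉ ∷ edgeList-unique (removeEdge M e)) (mk⇔ to from)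
    where
    e∉ : e ∉ edgeList (removeEdge M e)
    e∉ m = subst T (hasEdge-removeEdge-self M e) (∈-edgeList⁻ (removeEdge M e) m)
    to : ∀ {p} → p ∈ edgeList M → p ∈ e ∷ edgeList (removeEdge M e)
    to {p} m with p ≟ₚ e
    ... | yes refl = here refl
    ... | no p≢e = there (∈-edgeList⁺ (removeEdge M e)
                     (subst T (sym (hasEdge-removeEdge-other M p≢e)) (∈-edgeList⁻ M m)))
    from : ∀ {p} → p ∈ e ∷ edgeList (removeEdge M e) → p ∈ edgeList M
    from (here refl) = ∈-edgeList⁺ M he
    from (there m) = ∈-edgeList⁺ M (hasEdge-removeEdge⁻ M e _ (∈-edgeList⁻ (removeEdge M e) m))

  #edges-removeEdge : ∀ {n} (M : Matrix n) {e} → T (hasEdge M e) → #edges M ≡ suc (#edges (removeEdge M e))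
  #edges-removeEdge M {e} he = begin
    #edges M                                ≡⟨ #edges≡length-edgeList M ⟩
    length (edgeList M)                     ≡⟨ ↭.↭-length (edgeList-removeEdge M he) ⟩
    suc (length (edgeList (removeEdge M e))) ≡⟨ cong suc (sym (#edges≡length-edgeList (removeEdge M e))) ⟩
    suc (#edges (removeEdge M e))           ∎
    where open ≡-Reasoning

  T-injective : ∀ {a b : Bool} → (T a → T b) → (T b → T a) → a ≡ b
  T-injective {false} {false} _ _ = refl
  T-injective {false} {true}  _ g = ⊥-elim (g tt)
  T-injective {true}  {false} f _ = ⊥-elim (f tt)
  T-injective {true}  {true}  _ _ = refl

  module _ {G H : Digraph} (i : RegularMorphism G H) where
    private
      f : Fin (size G) → Fin (size H)
      f = vmap i
      f² : Pair (size G) → Pair (size H)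
      f² = Product.map f f

      f²-injective : ∀ {p q} → f² p ≡ f² q → p ≡ q
      f²-injective eq = cong₂ _,_ (injective i (cong proj₁ eq)) (injective i (cong proj₂ eq))

    hasEdge-imgM : ∀ (S : Matrix (size G)) e → hasEdge (imgM i S) (f² e) ≡ hasEdge S e
    hasEdge-imgM S (a , b) = T-injective to (imgM-intro i S a b)
      where
      to : T (hasEdge (imgM i S) (f a , f b)) → T (hasEdge S (a , b))
      to h with imgM-elim i S (f a) (f b) h
      ... | a′ , b′ , e , p , q with injective i p | injective i q
      ... | refl | refl = e

    hasEdge-imgM⁻ : ∀ (S : Matrix (size G)) p → T (hasEdge (imgM i S) p) → ∃ λ e → p ≡ f² e
    hasEdge-imgM⁻ S (u , v) h with imgM-elim i S u v h
    ... | a , b , _ , refl , refl = (a , b) , refl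

    edgeList-imgM : ∀ (S : Matrix (size G)) → edgeList (imgM i S) ↭ map f² (edgeList S)
    edgeList-imgM S = unique-sameMembers⇒↭ (edgeList-unique (imgM i S))
      (Unique.map⁺ f²-injective (edgeList-unique S)) (mk⇔ to from)
      where
      to : ∀ {p} → p ∈ edgeList (imgM i S) → p ∈ map f² (edgeList S)
      to {p} m with hasEdge-imgM⁻ S p (∈-edgeList⁻ (imgM i S) m)
      ... | e , refl = ∈-map⁺ f² (∈-edgeList⁺ S (subst T (hasEdge-imgM S e) (∈-edgeList⁻ (imgM i S) m)))
      from : ∀ {p} → p ∈ map f² (edgeList S) → p ∈ edgeList (imgM i S)
      from m with ∈-map⁻ f² m
      ... | e , m′ , refl = ∈-edgeList⁺ (imgM i S) (subst T (sym (hasEdge-imgM S e)) (∈-edgeList⁻ S m′))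

    #edges-imgM : ∀ (S : Matrix (size G)) → #edges (imgM i S) ≡ #edges S
    #edges-imgM S = begin
      #edges (imgM i S)              ≡⟨ #edges≡length-edgeList (imgM i S) ⟩
      length (edgeList (imgM i S))   ≡⟨ ↭.↭-length (edgeList-imgM S) ⟩
      length (map f² (edgeList S))   ≡⟨ length-map f² (edgeList S) ⟩
      length (edgeList S)            ≡⟨ sym (#edges≡length-edgeList S) ⟩
      #edges S                       ∎
      where open ≡-Reasoning

    imgM-removeEdge : ∀ (S : Matrix (size G)) e → imgM i (removeEdge S e) ≡ removeEdge (imgM i S) (f² e)
    imgM-removeEdge S e = matrix-ext λ u v → T-injective (to (u , v)) (from (u , v))
      where
      to : ∀ p → T (hasEdge (imgM i (removeEdge S e)) p) → T (hasEdge (removeEdge (imgM i S) (f² e)) p)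
      to p h with hasEdge-imgM⁻ (removeEdge S e) p h
      ... | q , refl with q ≟ₚ e
      ... | yes refl = ⊥-elim (subst T (trans (hasEdge-imgM (removeEdge S e) e) (hasEdge-removeEdge-self S e)) h)
      ... | no q≢e = subst T (sym (trans (hasEdge-removeEdge-other (imgM i S) (q≢e ∘ f²-injective))
                                         (trans (hasEdge-imgM S q) (sym (hasEdge-removeEdge-other S q≢e)))))
                            (subst T (hasEdge-imgM (removeEdge S e) q) h)
      from : ∀ p → T (hasEdge (removeEdge (imgM i S) (f² e)) p) → T (hasEdge (imgM i (removeEdge S e)) p)
      from p h with hasEdge-imgM⁻ S p (hasEdge-removeEdge⁻ (imgM i S) (f² e) p h)
      ... | q , refl with q ≟ₚ e
      ... | yes refl = ⊥-elim (subst T (hasEdge-removeEdge-self (imgM i S) (f² e)) h)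
      ... | no q≢e = subst T (sym (hasEdge-imgM (removeEdge S e) q))
                       (subst T (sym (hasEdge-removeEdge-other S q≢e))
                         (subst T (hasEdge-imgM S q) (hasEdge-removeEdge⁻ (imgM i S) (f² e) (f² q) h)))

  removeEdge-comm : ∀ {n} (M : Matrix n) e e′ → removeEdge (removeEdge M e) e′ ≡ removeEdge (removeEdge M e′) e
  removeEdge-comm M e e′ = matrix-ext λ u v → begin
    hasEdge (removeEdge (removeEdge M e) e′) (u , v)   ≡⟨ hasEdge-removeEdge (removeEdge M e) e′ (u , v) ⟩
    hasEdge (removeEdge M e) (u , v) ∧ keeps e′ u v    ≡⟨ cong (_∧ keeps e′ u v) (hasEdge-removeEdge M e (u , v)) ⟩
    (hasEdge M (u , v) ∧ keeps e u v) ∧ keeps e′ u v   ≡⟨ xy∙z≈xz∙y (hasEdge M (u , v)) (keeps e u v) (keeps e′ u v) ⟩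
    (hasEdge M (u , v) ∧ keeps e′ u v) ∧ keeps e u v   ≡⟨ cong (_∧ keeps e u v) (sym (hasEdge-removeEdge M e′ (u , v))) ⟩
    hasEdge (removeEdge M e′) (u , v) ∧ keeps e u v    ≡⟨ sym (hasEdge-removeEdge (removeEdge M e′) e (u , v)) ⟩
    hasEdge (removeEdge (removeEdge M e′) e) (u , v)   ∎
    where
    open ≡-Reasoning
    keeps : Pair _ → _ → _ → Bool
    keeps e u v = not ((u == proj₁ e) ∧ (v == proj₂ e))

  ∈-predsP⁺ : ∀ {G} (x : Multipath G) {e} → T (hasEdge (edges x) e) → removeMP x e ∈ predsP x
  ∈-predsP⁺ x he = ∈-map⁺ (removeMP x) (∈-edgeList⁺ (edges x) he)

  ∈-predsP⁻ : ∀ {G} (x : Multipath G) {a} → a ∈ predsP x →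
              ∃ λ e → T (hasEdge (edges x) e) × a ≡ removeMP x e
  ∈-predsP⁻ x m with ∈-map⁻ (removeMP x) m
  ... | e , m′ , eq = e , ∈-edgeList⁻ (edges x) m′ , eq

  removeMP-comm : ∀ {G} (x : Multipath G) e e′ → removeMP (removeMP x e) e′ ≡ removeMP (removeMP x e′) e
  removeMP-comm x e e′ = mp-ext (removeEdge-comm (edges x) e e′)

  removeMP-injective : ∀ {G} (x : Multipath G) {e e′} → T (hasEdge (edges x) e′) →
                       removeMP x e ≡ removeMP x e′ → e ≡ e′
  removeMP-injective x {e} {e′} he′ eq with e ≟ₚ e′
  ... | yes e≡e′ = e≡e′
  ... | no e≢e′ = ⊥-elim (subst T (hasEdge-removeEdge-self (edges x) e′)
                    (subst (λ y → T (hasEdge (edges y) e′)) eq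
                      (subst T (sym (hasEdge-removeEdge-other (edges x) (e≢e′ ∘ sym))) he′)))

  #edges-predsP : ∀ {G} (x : Multipath G) {a} → a ∈ predsP x → #edges (edges x) ≡ suc (#edges (edges a))
  #edges-predsP x m with ∈-predsP⁻ x m
  ... | e , he , refl = #edges-removeEdge (edges x) he

  module _ {G H : Digraph} (i : RegularMorphism G H) where

    ι-removeMP : ∀ (x : Multipath G) e → ι i (removeMP x e) ≡ removeMP (ι i x) (Product.map (vmap i) (vmap i) e)
    ι-removeMP x e = mp-ext (imgM-removeEdge i (edges x) e)

    ι-injective : ∀ {x y : Multipath G} → ι i x ≡ ι i y → x ≡ y
    ι-injective {x} {y} eq = trans (sym (pre∘img i x)) (trans (cong (preMP i) eq) (pre∘img i y))

    #edges-ι : ∀ (x : Multipath G) → #edges (edges (ι i x)) ≡ #edges (edges x)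
    #edges-ι x = #edges-imgM i (edges x)

    predsP-ι : ∀ (x : Multipath G) → predsP (ι i x) ↭ map (ι i) (predsP x)
    predsP-ι x = begin
      map (removeMP (ι i x)) (edgeList (imgM i (edges x)))
        ↭⟨ ↭.map⁺ (removeMP (ι i x)) (edgeList-imgM i (edges x)) ⟩
      map (removeMP (ι i x)) (map f² (edgeList (edges x)))
        ≡⟨ sym (map-∘ (edgeList (edges x))) ⟩
      map (removeMP (ι i x) ∘ f²) (edgeList (edges x))
        ≡⟨ map-cong (λ e → sym (ι-removeMP x e)) (edgeList (edges x)) ⟩
      map (ι i ∘ removeMP x) (edgeList (edges x))
        ≡⟨ map-∘ (edgeList (edges x)) ⟩
      map (ι i) (predsP x) ∎
      where
      open PermutationReasoning
      f² = Product.map (vmap i) (vmap i)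

    ι-covers : ∀ {a x : Multipath G} → a ∈ predsP x → ι i a ∈ predsP (ι i x)
    ι-covers {x = x} m = ↭.∈-resp-↭ (↭-sym (predsP-ι x)) (∈-map⁺ (ι i) m)

module SignTwists where
  open Multipaths
  open import Data.Nat using (suc)
  open import Data.Bool using (Bool; true; false; T; not; if_then_else_; _xor_)
  open import Data.Bool.Properties using (xor-assoc; xor-annihilates-not; xor-∧-commutativeRing)
  open import Algebra.Bundles using (CommutativeRing)
  open import Algebra.Properties.CommutativeSemigroup
    (CommutativeRing.+-commutativeSemigroup xor-∧-commutativeRing) using (interchange; x∙yz≈yx∙z)
  open import Data.List using (List; []; _∷_; map)
  open import Data.List.Relation.Unary.Any using (here; there)
  open import Data.List.Membership.Propositional using (_∈_)
  open import Data.List.Relation.Binary.Permutation.Propositional using (_↭_)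
  open import Data.Product using (∃; proj₁; proj₂)
  open import Data.Empty using (⊥-elim)
  open import Data.Unit using (tt)
  open import Function using (_∘_)
  open import Relation.Nullary using (yes; no)
  open import Relation.Binary.PropositionalEquality
    using (_≡_; _≢_; refl; sym; trans; cong; cong₂; subst; module ≡-Reasoning)

  -- On covers ε′ is ε plus the coboundary of g, so multiplication by (-1)^g turns the
  -- differential built from ε into the one built from ε′.
  record Twist (Q : Hasse) (ε ε′ : Elt Q → Elt Q → Bool) (g : Elt Q → Bool) : Set where
    constructor twisted
    field twist-≡ : ∀ {a y} → Covers Q a y → ε′ a y ≡ (g a xor ε a y) xor g y
  open Twist public

  module _ {Q : Hasse} where

    twist-sym : ∀ {ε ε′ g} → Twist Q ε ε′ g → Twist Q ε′ ε g
    twist-sym {ε} {ε′} {g} (twisted tw) = twisted λ {a} {y} a≺y →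
      trans (cancel (g a) (ε a y) (g y)) (cong (λ e → (g a xor e) xor g y) (sym (tw a≺y)))
      where
      cancel : ∀ u e v → e ≡ (u xor ((u xor e) xor v)) xor v
      cancel false false false = refl
      cancel false false true  = refl
      cancel false true  false = refl
      cancel false true  true  = refl
      cancel true  false false = refl
      cancel true  false true  = refl
      cancel true  true  false = refl
      cancel true  true  true  = refl

    twist-trans : ∀ {ε ε′ ε″ g h} → Twist Q ε ε′ g → Twist Q ε′ ε″ h →
                  Twist Q ε ε″ (λ y → g y xor h y)
    twist-trans {ε} {g = g} {h} (twisted tw) (twisted tw′) = twisted λ {a} {y} a≺y → begin
      _                                                  ≡⟨ tw′ a≺y ⟩
      (h a xor _) xor h y                                ≡⟨ cong (λ e → (h a xor e) xor h y) (tw a≺y) ⟩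
      (h a xor ((g a xor ε a y) xor g y)) xor h y        ≡⟨ cong (_xor h y) (sym (xor-assoc (h a) (g a xor ε a y) (g y))) ⟩
      ((h a xor (g a xor ε a y)) xor g y) xor h y        ≡⟨ xor-assoc (h a xor (g a xor ε a y)) (g y) (h y) ⟩
      (h a xor (g a xor ε a y)) xor (g y xor h y)        ≡⟨ cong (_xor (g y xor h y)) (x∙yz≈yx∙z (h a) (g a) (ε a y)) ⟩
      ((g a xor h a) xor ε a y) xor (g y xor h y)        ∎
      where open ≡-Reasoning

    twist-resp : ∀ {ε ε′ ε″ g} → (∀ {a y} → Covers Q a y → ε′ a y ≡ ε″ a y) →
                 Twist Q ε ε′ g → Twist Q ε ε″ g
    twist-resp same (twisted tw) = twisted λ a≺y → trans (sym (same a≺y)) (tw a≺y)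

  twist-comap : ∀ {Q Q′ : Hasse} (φ : Elt Q → Elt Q′) → (∀ {a y} → Covers Q a y → Covers Q′ (φ a) (φ y)) →
                ∀ {ε ε′ g} → Twist Q′ ε ε′ g →
                Twist Q (λ a y → ε (φ a) (φ y)) (λ a y → ε′ (φ a) (φ y)) (g ∘ φ)
  twist-comap φ φ-covers (twisted tw) = twisted λ a≺y → tw (φ-covers a≺y)

  module _ {G : Digraph} where

    pathSum : (Multipath G → Multipath G → Bool) → Multipath G → Pair (size G) → Pair (size G) → Bool
    pathSum σ x p q = σ (removeMP (removeMP x p) q) (removeMP x p) xor σ (removeMP x p) x

    Closed : (Multipath G → Multipath G → Bool) → Set
    Closed δ = ∀ x {p q} → p ≢ q → T (hasEdge (edges x) p) → T (hasEdge (edges x) q) →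
               pathSum δ x p q ≡ pathSum δ x q p

    module _ (δ : Multipath G → Multipath G → Bool) (closed : Closed δ) where

      -- δ summed along the chain that deletes the edges of x in the order of L; by closedness
      -- any edge may be deleted first (gaugeOn-step).
      gaugeOn : List (Pair (size G)) → Multipath G → Bool
      gaugeOn [] x = false
      gaugeOn (e ∷ L) x =
        if hasEdge (edges x) e then δ (removeMP x e) x xor gaugeOn L (removeMP x e) else gaugeOn L x

      gaugeOn-step : ∀ L x {p} → p ∈ L → T (hasEdge (edges x) p) →
                     gaugeOn L x ≡ δ (removeMP x p) x xor gaugeOn L (removeMP x p)
      gaugeOn-step (e ∷ L) x {p} p∈ hp with p ≟ₚ e
      ... | yes refl rewrite T→≡true hp | hasEdge-removeEdge-self (edges x) p = refl
      ... | no p≢e with p∈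
      ...   | here p≡e = ⊥-elim (p≢e p≡e)
      ...   | there p∈L rewrite hasEdge-removeEdge-other (edges x) (p≢e ∘ sym) with hasEdge (edges x) e in he
      ...     | false = gaugeOn-step L x p∈L hp
      ...     | true = begin
        δ xₑ x xor gaugeOn L xₑ                  ≡⟨ cong (δ xₑ x xor_) (gaugeOn-step L xₑ p∈L hp′) ⟩
        δ xₑ x xor (δ xₑₚ xₑ xor c)              ≡⟨ x∙yz≈yx∙z (δ xₑ x) (δ xₑₚ xₑ) c ⟩
        pathSum δ x e p xor c                    ≡⟨ cong (_xor c) (closed x (p≢e ∘ sym) (subst T (sym he) tt) hp) ⟩
        pathSum δ x p e xor c                    ≡⟨ sym (x∙yz≈yx∙z (δ xₚ x) (δ xₚₑ xₚ) c) ⟩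
        δ xₚ x xor (δ xₚₑ xₚ xor c)              ≡⟨ cong (λ y → δ xₚ x xor (δ xₚₑ xₚ xor gaugeOn L y)) (removeMP-comm x e p) ⟩
        δ xₚ x xor (δ xₚₑ xₚ xor gaugeOn L xₚₑ)  ∎
        where
        open ≡-Reasoning
        xₑ xₚ xₑₚ xₚₑ : Multipath G
        xₑ = removeMP x e
        xₚ = removeMP x p
        xₑₚ = removeMP xₑ p
        xₚₑ = removeMP xₚ e
        hp′ : T (hasEdge (edges xₑ) p)
        hp′ = subst T (sym (hasEdge-removeEdge-other (edges x) p≢e)) hp
        c : Bool
        c = gaugeOn L xₑₚ

      closed⇒coboundary : ∃ λ g → ∀ {a x} → a ∈ predsP x → g x ≡ δ a x xor g a
      closed⇒coboundary = gaugeOn (allPairs (size G)) , coboundary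
        where
        coboundary : ∀ {a x} → a ∈ predsP x → gaugeOn (allPairs (size G)) x ≡ δ a x xor gaugeOn (allPairs (size G)) a
        coboundary {x = x} a≺x with ∈-predsP⁻ x a≺x
        ... | p , hp , refl = gaugeOn-step (allPairs (size G)) x (∈-allPairs p) hp

    pathSum-xor : ∀ (σ σ′ : Multipath G → Multipath G → Bool) x p q →
                  pathSum (λ a y → σ a y xor σ′ a y) x p q ≡ pathSum σ x p q xor pathSum σ′ x p q
    pathSum-xor σ σ′ x p q = interchange (σ xₚq xₚ) (σ′ xₚq xₚ) (σ xₚ x) (σ′ xₚ x)
      where
      xₚ xₚq : Multipath G
      xₚ = removeMP x p
      xₚq = removeMP xₚ q

    AntiSquare : (Multipath G → Multipath G → Bool) → Set
    AntiSquare σ = ∀ x {p q} → p ≢ q → T (hasEdge (edges x) p) → T (hasEdge (edges x) q) →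
                   pathSum σ x p q ≡ not (pathSum σ x q p)

    antiSquare-xor-closed : ∀ {σ σ′} → AntiSquare σ → AntiSquare σ′ → Closed (λ a y → σ a y xor σ′ a y)
    antiSquare-xor-closed {σ} {σ′} anti anti′ x {p} {q} p≢q hp hq = begin
      pathSum (λ a y → σ a y xor σ′ a y) x p q            ≡⟨ pathSum-xor σ σ′ x p q ⟩
      pathSum σ x p q xor pathSum σ′ x p q                 ≡⟨ cong₂ _xor_ (anti x p≢q hp hq) (anti′ x p≢q hp hq) ⟩
      not (pathSum σ x q p) xor not (pathSum σ′ x q p)     ≡⟨ xor-annihilates-not (pathSum σ x q p) (pathSum σ′ x q p) ⟩
      pathSum σ x q p xor pathSum σ′ x q p                 ≡⟨ sym (pathSum-xor σ σ′ x q p) ⟩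
      pathSum (λ a y → σ a y xor σ′ a y) x q p            ∎
      where open ≡-Reasoning

    signAssignment-antiSquare : (Q : Hasse) (t : SignAssignment Q) (φ : Multipath G → Elt Q) →
      (∀ {a y} → φ a ≡ φ y → a ≡ y) → (∀ {a y} → a ∈ predsP y → Covers Q (φ a) (φ y)) →
      AntiSquare (λ a y → sign t (φ a) (φ y))
    signAssignment-antiSquare Q t φ φ-injective φ-covers x {p} {q} p≢q hp hq
      rewrite removeMP-comm x q p =
      isSign t (p≢q ∘ removeMP-injective x hq ∘ φ-injective)
        (φ-covers (∈-predsP⁺ (removeMP x p) hq′))
        (φ-covers (subst (_∈ predsP (removeMP x q)) (removeMP-comm x q p) (∈-predsP⁺ (removeMP x q) hp′)))
        (φ-covers (∈-predsP⁺ x hp)) (φ-covers (∈-predsP⁺ x hq))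
      where
      hq′ : T (hasEdge (edges (removeMP x p)) q)
      hq′ = subst T (sym (hasEdge-removeEdge-other (edges x) (p≢q ∘ sym))) hq
      hp′ : T (hasEdge (edges (removeMP x q)) p)
      hp′ = subst T (sym (hasEdge-removeEdge-other (edges x) p≢q)) hp

  -- Only the existence of the gauge matters, and unfolding it is prohibitively expensive.
  opaque
    twist-exists : ∀ {G} (s : SignAssignment (P G)) (Q : Hasse) (t : SignAssignment Q) (φ : Multipath G → Elt Q) →
      (∀ {a y} → φ a ≡ φ y → a ≡ y) → (∀ {a y} → a ∈ predsP y → Covers Q (φ a) (φ y)) →
      ∃ (Twist (P G) (sign s) (λ a y → sign t (φ a) (φ y)))
    twist-exists {G} s Q t φ φ-injective φ-covers = proj₁ gauge , twisted λ {a} {y} a≺y →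
      solve (sign t (φ a) (φ y)) (sign s a y) (proj₁ gauge a) (proj₂ gauge a≺y)
      where
      gauge : Σ (Multipath G → Bool) λ g → ∀ {a y} → a ∈ predsP y → g y ≡ (sign t (φ a) (φ y) xor sign s a y) xor g a
      gauge = closed⇒coboundary (λ a y → sign t (φ a) (φ y) xor sign s a y)
                (antiSquare-xor-closed {σ = λ a y → sign t (φ a) (φ y)} {σ′ = sign s}
                                       (signAssignment-antiSquare Q t φ φ-injective φ-covers)
                                       (signAssignment-antiSquare (P G) s (λ a → a) (λ e → e) (λ a≺y → a≺y)))
      solve : ∀ u e v {w} → w ≡ (u xor e) xor v → u ≡ (v xor e) xor w
      solve false false false refl = refl
      solve false false true  refl = refl
      solve false true  false refl = refl
      solve false true  true  refl = refl
      solve true  false false refl = refl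
      solve true  false true  refl = refl
      solve true  true  false refl = refl
      solve true  true  true  refl = refl

  record TwistedCoverMap (X Y : Signed) : Set where
    field
      mapElt     : Elt (poset Y) → Elt (poset X)
      twist      : Elt (poset Y) → Bool
      preds-↭    : ∀ y → preds (poset X) (mapElt y) ↭ map mapElt (preds (poset Y) y)
      level-≡    : ∀ y → level (poset X) (mapElt y) ≡ level (poset Y) y
      sign-twist : Twist (poset Y) (ε Y) (λ a y → ε X (mapElt a) (mapElt y)) twist

  LevelledCovers : Hasse → Set
  LevelledCovers Q = ∀ {a y} → Covers Q a y → level Q y ≡ suc (level Q a)

module Gluing where
  open Multipaths
  open import Data.List using (map)
  open import Data.List.Properties using (map-cong; map-∘)
  open import Data.List.Relation.Binary.Permutation.Propositional
    using (_↭_; ↭-refl; ↭-sym; module PermutationReasoning)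
  import Data.List.Relation.Binary.Permutation.Propositional.Properties as ↭
  open import Data.Empty using (⊥-elim; ⊥-elim-irr)
  open import Function using (_∘_)
  open import Relation.Nullary using (¬_; Dec; yes; no)
  open import Relation.Binary.PropositionalEquality using (_≡_; refl; sym; trans; cong)

  module _ {G G₁ G₂ : Digraph} (i₁ : RegularMorphism G G₁) (i₂ : RegularMorphism G G₂) where

    left-injective : ∀ {x x′ : Multipath G₁} → left {i₁ = i₁} {i₂ = i₂} x ≡ left x′ → x ≡ x′
    left-injective refl = refl

    class₂-ι : ∀ y → class₂ i₁ i₂ (ι i₂ y) ≡ left (ι i₁ y)
    class₂-ι y with inImage? i₂ (ι i₂ y)
    ... | yes (y′ , eq) = cong (left ∘ ι i₁) (ι-injective i₂ {y′} {y} eq)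
    ... | no ∉image = ⊥-elim (∉image (y , refl))

    class₂-outside : ∀ z → .(∉image : ¬ InImage i₂ z) → class₂ i₁ i₂ z ≡ right z ∉image
    class₂-outside z ∉image with inImage? i₂ z
    ... | yes ∈image = ⊥-elim-irr (∉image ∈image)
    ... | no _ = refl

    class₂-injective : ∀ {z z′} → class₂ i₁ i₂ z ≡ class₂ i₁ i₂ z′ → z ≡ z′
    class₂-injective {z} {z′} = by-cases (inImage? i₂ z) (inImage? i₂ z′)
      where
      by-cases : ∀ {z z′} → Dec (InImage i₂ z) → Dec (InImage i₂ z′) →
                 class₂ i₁ i₂ z ≡ class₂ i₁ i₂ z′ → z ≡ z′
      by-cases (yes (y , refl)) (yes (y′ , refl)) eq =
        cong (ι i₂) (ι-injective i₁ {y} {y′} (left-injective (trans (sym (class₂-ι y)) (trans eq (class₂-ι y′)))))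
      by-cases {z′ = z′} (yes (y , refl)) (no ∉image′) eq
        with () ← trans (sym (class₂-ι y)) (trans eq (class₂-outside z′ ∉image′))
      by-cases {z} (no ∉image) (yes (y′ , refl)) eq
        with () ← trans (sym (class₂-outside z ∉image)) (trans eq (class₂-ι y′))
      by-cases {z} {z′} (no ∉image) (no ∉image′) eq
        with refl ← trans (sym (class₂-outside z ∉image)) (trans eq (class₂-outside z′ ∉image′)) = refl

    level∇-class₂ : ∀ z → level∇ i₁ i₂ (class₂ i₁ i₂ z) ≡ #edges (edges z)
    level∇-class₂ z with inImage? i₂ z
    ... | yes (y , refl) = trans (#edges-ι i₁ y) (sym (#edges-ι i₂ y))
    ... | no _ = refl

    preds∇-class₂ : ∀ z → preds∇ i₁ i₂ (class₂ i₁ i₂ z) ↭ map (class₂ i₁ i₂) (predsP z)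
    preds∇-class₂ z with inImage? i₂ z
    ... | no _ = ↭-refl
    ... | yes (y , refl) = begin
      map left (predsP (ι i₁ y))            ↭⟨ ↭.map⁺ left (predsP-ι i₁ y) ⟩
      map left (map (ι i₁) (predsP y))      ≡⟨ sym (map-∘ (predsP y)) ⟩
      map (left ∘ ι i₁) (predsP y)          ≡⟨ map-cong (λ a → sym (class₂-ι a)) (predsP y) ⟩
      map (class₂ i₁ i₂ ∘ ι i₂) (predsP y)  ≡⟨ map-∘ (predsP y) ⟩
      map (class₂ i₁ i₂) (map (ι i₂) (predsP y)) ↭⟨ ↭.map⁺ (class₂ i₁ i₂) (↭-sym (predsP-ι i₂ y)) ⟩
      map (class₂ i₁ i₂) (predsP (ι i₂ y))  ∎
      where open PermutationReasoning

module CochainAlgebra {c ℓ} (K : Field c ℓ) where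
  open Multipaths
  open SignTwists
  open import Level using (_⊔_)
  open import Data.Nat using (suc)
  open import Data.Nat.Properties using (suc-injective)
  open import Data.Bool using (Bool; true; false; T; not; if_then_else_; _xor_)
  open import Data.Bool.Properties using (xor-comm; xor-same)
  open import Data.List using (List; []; _∷_; map; filterᵇ)
  open import Data.List.Properties using (map-∘)
  open import Data.List.Relation.Unary.Any using (here; there)
  open import Data.List.Membership.Propositional using (_∈_)
  open import Data.List.Relation.Binary.Permutation.Propositional using (_↭_; ↭-sym; ↭⇒↭ₛ′)
  import Data.List.Relation.Binary.Permutation.Propositional.Properties as ↭
  import Data.List.Relation.Binary.Permutation.Setoid.Properties as ↭ₛ
  open import Data.Sum using (inj₁; inj₂)
  open import Function using (_∘_)
  open import Relation.Nullary using (yes; no)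
  import Relation.Binary.PropositionalEquality as ≡
  open ≡ using (_≡_; _≢_)
  import Algebra.Properties.Ring as RingProperties
  import Algebra.Properties.AbelianGroup as AbelianGroupProperties
  import Algebra.Properties.CommutativeSemigroup as CommutativeSemigroupProperties
  import Relation.Binary.Reasoning.Setoid as SetoidReasoning

  open Field K
  open Cochains K
  open RingProperties ring using (-1*x≈-x; -‿distribʳ-*)
  open CommutativeSemigroupProperties +-commutativeSemigroup using (interchange)
  open SetoidReasoning setoid

  infix 4 _≐_
  _≐_ : ∀ {E : Set} → (E → Carrier) → (E → Carrier) → Set ℓ
  f ≐ g = ∀ x → f x ≈ g x

  sumK-cong : ∀ {E : Set} {g h : E → Carrier} L → (∀ {x} → x ∈ L → g x ≈ h x) →
              sumK (map g L) ≈ sumK (map h L)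
  sumK-cong [] _ = refl
  sumK-cong (x ∷ L) g≈h = +-cong (g≈h (here ≡.refl)) (sumK-cong L (g≈h ∘ there))

  sumK-+ : ∀ {E : Set} (g h : E → Carrier) L →
           sumK (map (λ x → g x + h x) L) ≈ sumK (map g L) + sumK (map h L)
  sumK-+ g h [] = sym (+-identityˡ 0#)
  sumK-+ g h (x ∷ L) = trans (+-congˡ (sumK-+ g h L)) (interchange (g x) (h x) _ _)

  *-sumK : ∀ {E : Set} a (g : E → Carrier) L → a * sumK (map g L) ≈ sumK (map (λ x → a * g x) L)
  *-sumK a g [] = zeroʳ a
  *-sumK a g (x ∷ L) = trans (distribˡ a _ _) (+-congˡ (*-sumK a g L))

  sumK-zero : ∀ {E : Set} (g : E → Carrier) L → (∀ x → g x ≈ 0#) → sumK (map g L) ≈ 0#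
  sumK-zero g [] _ = refl
  sumK-zero g (x ∷ L) g≈0 = trans (+-cong (g≈0 x) (sumK-zero g L g≈0)) (+-identityˡ 0#)

  sumK-↭ : ∀ {E : Set} (g : E → Carrier) {xs ys} → xs ↭ ys → sumK (map g xs) ≈ sumK (map g ys)
  sumK-↭ g xs↭ys = ↭ₛ.foldr-commMonoid setoid +-isCommutativeMonoid (↭⇒↭ₛ′ isEquivalence (↭.map⁺ g xs↭ys))

  sumK-filterᵇ : ∀ {E : Set} (g : E → Carrier) (p : E → Bool) L →
                 sumK (map g (filterᵇ p L)) ≈ sumK (map (λ x → if p x then g x else 0#) L)
  sumK-filterᵇ g p [] = refl
  sumK-filterᵇ g p (x ∷ L) with p x
  ... | true  = +-congˡ (sumK-filterᵇ g p L)
  ... | false = trans (sumK-filterᵇ g p L) (sym (+-identityˡ _))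

  sumK-antisymmetric : ∀ {E : Set} (T : E → E → Carrier) → (∀ p → T p p ≈ 0#) →
                       (∀ p q → T p q + T q p ≈ 0#) → ∀ L → sumK (map (λ p → sumK (map (T p) L)) L) ≈ 0#
  sumK-antisymmetric T diag anti [] = refl
  sumK-antisymmetric T diag anti (x ∷ L) = begin
    (T x x + row) + sumK (map (λ p → T p x + sumK (map (T p) L)) L)
      ≈⟨ +-cong (+-cong (diag x) refl) (sumK-+ (λ p → T p x) (λ p → sumK (map (T p) L)) L) ⟩
    (0# + row) + (col + sumK (map (λ p → sumK (map (T p) L)) L))
      ≈⟨ +-cong (+-identityˡ row) (+-congˡ (sumK-antisymmetric T diag anti L)) ⟩
    row + (col + 0#)   ≈⟨ +-congˡ (+-identityʳ col) ⟩
    row + col          ≈⟨ sym (sumK-+ (T x) (λ p → T p x) L) ⟩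
    sumK (map (λ p → T x p + T p x) L) ≈⟨ sumK-zero _ L (anti x) ⟩
    0# ∎
    where
    row col : Carrier
    row = sumK (map (T x) L)
    col = sumK (map (λ p → T p x) L)

  record Linear {E E′ : Set} (M : (E → Carrier) → (E′ → Carrier)) : Set (c ⊔ ℓ) where
    field
      ≐-cong : ∀ {f g} → f ≐ g → M f ≐ M g
      +-homo  : ∀ f g → M (f +c g) ≐ M f +c M g
      ·-homo  : ∀ a f → M (a ·c f) ≐ a ·c M f

    0-homo : M 0c ≐ 0c
    0-homo x = begin
      M 0c x          ≈⟨ ≐-cong (λ _ → sym (zeroˡ 0#)) x ⟩
      M (0# ·c 0c) x  ≈⟨ ·-homo 0# 0c x ⟩
      0# * M 0c x     ≈⟨ zeroˡ _ ⟩
      0#              ∎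

    -‿homo : ∀ f g → M (f -c g) ≐ M f -c M g
    -‿homo f g x = begin
      M (f -c g) x                ≈⟨ ≐-cong (λ y → +-congˡ (sym (-1*x≈-x (g y)))) x ⟩
      M (f +c ((- 1#) ·c g)) x    ≈⟨ +-homo f _ x ⟩
      M f x + M ((- 1#) ·c g) x   ≈⟨ +-congˡ (trans (·-homo _ g x) (-1*x≈-x _)) ⟩
      M f x - M g x               ∎

  open Linear public

  -‿linear : ∀ {E E′ : Set} {M N : (E → Carrier) → (E′ → Carrier)} →
             Linear M → Linear N → Linear (λ f → M f -c N f)
  -‿linear {M = M} {N} LM LN = record
    { ≐-cong = λ f≐g x → +-cong (≐-cong LM f≐g x) (-‿cong (≐-cong LN f≐g x))
    ; +-homo = λ f g x → begin
        M (f +c g) x - N (f +c g) x             ≈⟨ +-cong (+-homo LM f g x) (-‿cong (+-homo LN f g x)) ⟩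
        (M f x + M g x) - (N f x + N g x)       ≈⟨ +-congˡ (sym (⁻¹-∙-comm (N f x) (N g x))) ⟩
        (M f x + M g x) + (- N f x + - N g x)   ≈⟨ interchange (M f x) (M g x) (- N f x) (- N g x) ⟩
        (M f x - N f x) + (M g x - N g x)       ∎
    ; ·-homo = λ a f x → begin
        M (a ·c f) x - N (a ·c f) x             ≈⟨ +-cong (·-homo LM a f x) (-‿cong (·-homo LN a f x)) ⟩
        a * M f x - a * N f x                   ≈⟨ +-congˡ (-‿distribʳ-* a (N f x)) ⟩
        a * M f x + a * - N f x                 ≈⟨ sym (distribˡ a (M f x) (- N f x)) ⟩
        a * (M f x - N f x)                     ∎
    }
    where open AbelianGroupProperties +-abelianGroup using (⁻¹-∙-comm)

  Graded : (X Y : Signed) → (Cochain X → Cochain Y) → Set (c ⊔ ℓ)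
  Graded X Y M = ∀ n {f g} → Eq X n f g → Eq Y n (M f) (M g)

  d-linear : (X : Signed) → Linear (d X)
  d-linear X = record
    { ≐-cong = λ f≐g y → sumK-cong (preds (poset X) y) (λ {x} _ → *-congˡ (f≐g x))
    ; +-homo  = λ f g y → trans (sumK-cong (preds (poset X) y) (λ _ → distribˡ _ _ _))
                               (sumK-+ _ _ (preds (poset X) y))
    ; ·-homo  = λ a f y → trans (sumK-cong (preds (poset X) y) (λ _ → x∙yz≈y∙xz _ a _))
                               (sym (*-sumK a _ (preds (poset X) y)))
    }
    where open CommutativeSemigroupProperties *-commutativeSemigroup using (x∙yz≈y∙xz)

  d-graded : (X : Signed) → LevelledCovers (poset X) → ∀ n {f g} →
             Eq X n f g → Eq X (suc n) (d X f) (d X g)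
  d-graded X levelled n f≈g y ly = sumK-cong (preds (poset X) y)
    λ x≺y → *-congˡ (f≈g _ (suc-injective (≡.trans (≡.sym (levelled x≺y)) ly)))

  d-level0 : (X : Signed) → LevelledCovers (poset X) → ∀ f y → level (poset X) y ≡ 0 → d X f y ≈ 0#
  d-level0 X levelled f y ly with preds (poset X) y in eq
  ... | [] = refl
  ... | a ∷ _ with () ← ≡.trans (≡.sym (levelled (≡.subst (a ∈_) (≡.sym eq) (here ≡.refl)))) ly

  d-⊕-inj₁ : ∀ X Y (f : Cochain (X ⊕ Y)) x → d (X ⊕ Y) f (inj₁ x) ≡ d X (f ∘ inj₁) x
  d-⊕-inj₁ X Y f x = ≡.cong sumK (≡.sym (map-∘ (preds (poset X) x)))

  d-⊕-inj₂ : ∀ X Y (f : Cochain (X ⊕ Y)) y → d (X ⊕ Y) f (inj₂ y) ≡ d Y (f ∘ inj₂) y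
  d-⊕-inj₂ X Y f y = ≡.cong sumK (≡.sym (map-∘ (preds (poset Y) y)))

  sgn-xor : ∀ a b w → sgn a * (sgn b * w) ≈ sgn (a xor b) * w
  sgn-xor false b     w = *-identityˡ _
  sgn-xor true  false w = *-congˡ (*-identityˡ w)
  sgn-xor true  true  w = begin
    - 1# * (- 1# * w) ≈⟨ -1*x≈-x _ ⟩
    - (- 1# * w)      ≈⟨ -‿cong (-1*x≈-x w) ⟩
    - - w             ≈⟨ ⁻¹-involutive w ⟩
    w                 ≈⟨ sym (*-identityˡ w) ⟩
    1# * w            ∎
    where open import Algebra.Properties.Group +-group using (⁻¹-involutive)

  sgn-sgn : ∀ a w → sgn a * (sgn a * w) ≈ w
  sgn-sgn a w = trans (sgn-xor a a w) (trans (*-congʳ (reflexive (≡.cong sgn (xor-same a)))) (*-identityˡ w))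

  sgn-swap : ∀ {a b a′ b′} w → a xor b ≡ a′ xor b′ → sgn a * (sgn b * w) ≈ sgn a′ * (sgn b′ * w)
  sgn-swap {a} {b} {a′} {b′} w eq =
    trans (sgn-xor a b w) (trans (*-congʳ (reflexive (≡.cong sgn eq))) (sym (sgn-xor a′ b′ w)))

  sgn-twist : ∀ e u v w → sgn e * (sgn u * w) ≈ sgn v * (sgn ((u xor e) xor v) * w)
  sgn-twist e u v w = trans (sgn-xor e u w) (trans (*-congʳ (reflexive (≡.cong sgn (table e u v))))
                                                   (sym (sgn-xor v ((u xor e) xor v) w)))
    where
    table : ∀ e u v → e xor u ≡ v xor ((u xor e) xor v)
    table false false false = ≡.refl
    table false false true  = ≡.refl
    table false true  false = ≡.refl
    table false true  true  = ≡.refl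
    table true  false false = ≡.refl
    table true  false true  = ≡.refl
    table true  true  false = ≡.refl
    table true  true  true  = ≡.refl

  sgn-not : ∀ a w → sgn a * w + sgn (not a) * w ≈ 0#
  sgn-not false w = trans (+-cong (*-identityˡ w) (-1*x≈-x w)) (-‿inverseʳ w)
  sgn-not true  w = trans (+-cong (-1*x≈-x w) (*-identityˡ w)) (-‿inverseˡ w)

  module _ {X Y : Signed} (φ : TwistedCoverMap X Y) where
    open TwistedCoverMap φ

    pullback : Cochain X → Cochain Y
    pullback f y = sgn (twist y) * f (mapElt y)

    pullback-linear : Linear pullback
    pullback-linear = record
      { ≐-cong = λ f≐g y → *-congˡ (f≐g (mapElt y))
      ; +-homo = λ f g y → distribˡ _ _ _
      ; ·-homo = λ a f y → x∙yz≈y∙xz _ a _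
      }
      where open CommutativeSemigroupProperties *-commutativeSemigroup using (x∙yz≈y∙xz)

    pullback-graded : Graded X Y pullback
    pullback-graded n f≈g y ly = *-congˡ (f≈g (mapElt y) (≡.trans (level-≡ y) ly))

    pullback-d : ∀ f → d Y (pullback f) ≐ pullback (d X f)
    pullback-d f y = begin
      sumK (map (λ a → sgn (ε Y a y) * (sgn (twist a) * f (mapElt a))) Ly)
        ≈⟨ sumK-cong Ly (λ {a} a≺y → ≡.subst (λ e → _ ≈ sgn (twist y) * (sgn e * f (mapElt a)))
                                             (≡.sym (twist-≡ sign-twist a≺y))
                                             (sgn-twist (ε Y a y) (twist a) (twist y) (f (mapElt a)))) ⟩
      sumK (map (λ a → sgn (twist y) * (sgn (ε X (mapElt a) (mapElt y)) * f (mapElt a))) Ly)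
        ≈⟨ sym (*-sumK (sgn (twist y)) _ Ly) ⟩
      sgn (twist y) * sumK (map ((λ b → sgn (ε X b (mapElt y)) * f b) ∘ mapElt) Ly)
        ≈⟨ *-congˡ (reflexive (≡.cong sumK (map-∘ Ly))) ⟩
      sgn (twist y) * sumK (map (λ b → sgn (ε X b (mapElt y)) * f b) (map mapElt Ly))
        ≈⟨ *-congˡ (sumK-↭ _ (↭-sym (preds-↭ y))) ⟩
      pullback (d X f) y ∎
      where
      Ly : List (Elt (poset Y))
      Ly = preds (poset Y) y

  module _ {G : Digraph} (s : SignAssignment (P G)) where
    private
      X : Signed
      X = signed (P G) s
      σ : Multipath G → Multipath G → Bool
      σ = sign s
      L : List (Pair (size G))
      L = allPairs (size G)

    sumK-predsP : ∀ (g : Multipath G → Carrier) x →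
      sumK (map g (predsP x)) ≈ sumK (map (λ p → if hasEdge (edges x) p then g (removeMP x p) else 0#) L)
    sumK-predsP g x = trans (reflexive (≡.cong sumK (≡.sym (map-∘ (edgeList (edges x))))))
                            (sumK-filterᵇ (g ∘ removeMP x) (hasEdge (edges x)) L)

    square-cancels : ∀ x {p q} → p ≢ q → T (hasEdge (edges x) p) → T (hasEdge (edges x) q) → ∀ w →
      let xp = removeMP x p ; xq = removeMP x q in
      sgn (σ xp x) * (sgn (σ (removeMP xp q) xp) * w) + sgn (σ xq x) * (sgn (σ (removeMP xq p) xq) * w) ≈ 0#
    square-cancels x {p} {q} p≢q hp hq w = begin
      sgn (σ xp x) * (sgn (σ (removeMP xp q) xp) * w) + sgn (σ xq x) * (sgn (σ (removeMP xq p) xq) * w)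
        ≈⟨ +-cong (sgn-xor (σ xp x) (σ (removeMP xp q) xp) w) (sgn-xor (σ xq x) (σ (removeMP xq p) xq) w) ⟩
      sgn (σ xp x xor σ (removeMP xp q) xp) * w + sgn (σ xq x xor σ (removeMP xq p) xq) * w
        ≈⟨ +-cong (*-congʳ (reflexive (≡.cong sgn (≡.trans (xor-comm (σ xp x) _) anti))))
                  (*-congʳ (reflexive (≡.cong sgn (xor-comm (σ xq x) _)))) ⟩
      sgn (not (pathSum σ x q p)) * w + sgn (pathSum σ x q p) * w
        ≈⟨ +-comm _ _ ⟩
      sgn (pathSum σ x q p) * w + sgn (not (pathSum σ x q p)) * w
        ≈⟨ sgn-not (pathSum σ x q p) w ⟩
      0# ∎
      where
      xp xq : Multipath G
      xp = removeMP x p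
      xq = removeMP x q
      anti = signAssignment-antiSquare (P G) s (λ a → a) (λ e → e) (λ a≺y → a≺y) x p≢q hp hq

    d²≐0 : ∀ f → d X (d X f) ≐ 0c
    d²≐0 f x = begin
      d X (d X f) x
        ≈⟨ sumK-predsP (λ y → sgn (σ y x) * d X f y) x ⟩
      sumK (map (λ p → if hasEdge (edges x) p then sgn (σ (removeMP x p) x) * d X f (removeMP x p) else 0#) L)
        ≈⟨ sumK-cong L (λ {p} _ → expand p) ⟩
      sumK (map (λ p → sumK (map (term p) L)) L)
        ≈⟨ sumK-antisymmetric term diag anti L ⟩
      0# ∎
      where
      -- The contribution of f (x − p − q) to d (d f) x through x − p; the two routes around
      -- each square cancel by the sign condition.
      term : Pair (size G) → Pair (size G) → Carrier
      term p q = if hasEdge (edges x) p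
                 then (if hasEdge (edges (removeMP x p)) q
                       then sgn (σ (removeMP x p) x) * (sgn (σ (removeMP (removeMP x p) q) (removeMP x p))
                              * f (removeMP (removeMP x p) q))
                       else 0#)
                 else 0#

      expand : ∀ p → (if hasEdge (edges x) p then sgn (σ (removeMP x p) x) * d X f (removeMP x p) else 0#)
                     ≈ sumK (map (term p) L)
      expand p with hasEdge (edges x) p
      ... | false = sym (sumK-zero _ L (λ _ → refl))
      ... | true = trans (*-congˡ (sumK-predsP _ (removeMP x p)))
                         (trans (*-sumK _ _ L) (sumK-cong L (λ {q} _ → push q)))
        where
        push : ∀ q → sgn (σ (removeMP x p) x) * (if hasEdge (edges (removeMP x p)) q
                                                  then sgn (σ (removeMP (removeMP x p) q) (removeMP x p))
                                                         * f (removeMP (removeMP x p) q)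
                                                  else 0#)
                 ≈ (if hasEdge (edges (removeMP x p)) q
                    then sgn (σ (removeMP x p) x) * (sgn (σ (removeMP (removeMP x p) q) (removeMP x p))
                           * f (removeMP (removeMP x p) q))
                    else 0#)
        push q with hasEdge (edges (removeMP x p)) q
        ... | true  = refl
        ... | false = zeroʳ _

      diag : ∀ p → term p p ≈ 0#
      diag p with hasEdge (edges x) p
      ... | false = refl
      ... | true rewrite hasEdge-removeEdge-self (edges x) p = refl

      anti : ∀ p q → term p q + term q p ≈ 0#
      anti p q with p ≟ₚ q
      ... | yes ≡.refl = trans (+-cong (diag p) (diag p)) (+-identityˡ 0#)
      ... | no p≢q rewrite hasEdge-removeEdge-other (edges x) {p} {q} (p≢q ∘ ≡.sym)
                         | hasEdge-removeEdge-other (edges x) {q} {p} p≢q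
        with hasEdge (edges x) p in hp | hasEdge (edges x) q in hq
      ...   | false | false = +-identityˡ 0#
      ...   | false | true  = +-identityˡ 0#
      ...   | true  | false = +-identityʳ 0#
      ...   | true  | true  = trans (+-congˡ (*-congˡ (*-congˡ (reflexive (≡.cong f (removeMP-comm x q p))))))
                                    (square-cancels x p≢q (≡.subst T (≡.sym hp) _) (≡.subst T (≡.sym hq) _) _)

module SplitExact {c ℓ} (K : Field c ℓ) where
  open SignTwists using (LevelledCovers)
  open import Level using (_⊔_)
  open import Data.Nat using (suc)
  open import Data.Product using (∃)
  import Relation.Binary.PropositionalEquality as ≡
  import Algebra.Properties.AbelianGroup as AbelianGroupProperties
  import Relation.Binary.Reasoning.Setoid as SetoidReasoning

  open Field K
  open Cochains K
  open CochainAlgebra K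
  open AbelianGroupProperties +-abelianGroup
    using (ε⁻¹≈ε; ⁻¹-anti-homo‿-; xyx⁻¹≈y; x∙y⁻¹≈ε⇒x≈y; x≈y⇒x∙y⁻¹≈ε)
  open SetoidReasoning setoid

  x-0≈x : ∀ x → x - 0# ≈ x
  x-0≈x x = trans (+-congˡ ε⁻¹≈ε) (+-identityʳ x)

  x-[x-y]≈y : ∀ x y → x - (x - y) ≈ y
  x-[x-y]≈y x y = begin
    x - (x - y)   ≈⟨ +-congˡ (⁻¹-anti-homo‿- x y) ⟩
    x + (y - x)   ≈⟨ +-comm x (y - x) ⟩
    (y - x) + x   ≈⟨ +-assoc y (- x) x ⟩
    y + (- x + x) ≈⟨ +-congˡ (-‿inverseˡ x) ⟩
    y + 0#        ≈⟨ +-identityʳ y ⟩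
    y             ∎

  y+[x-y]≈x : ∀ x y → y + (x - y) ≈ x
  y+[x-y]≈x x y = trans (+-comm y (x - y)) (trans (+-assoc x (- y) y) (trans (+-congˡ (-‿inverseˡ y)) (+-identityʳ x)))

  x-y≈z⇒y≈x-z : ∀ {x y z} → x - y ≈ z → y ≈ x - z
  x-y≈z⇒y≈x-z {x} {y} e = trans (sym (x-[x-y]≈y x y)) (+-congˡ (-‿cong e))

  ≐⇒Eq : ∀ {X : Signed} n {f g : Cochain X} → f ≐ g → Eq X n f g
  ≐⇒Eq n f≐g x _ = f≐g x

  ≐⇒Cohomologous : ∀ {X : Signed} n {f g : Cochain X} → f ≐ g → Cohomologous X n f g
  ≐⇒Cohomologous {X} n f≐g = 0c , λ x _ → trans (x≈y⇒x∙y⁻¹≈ε (f≐g x)) (sym (0-homo (d-linear X) x))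

  record SplitShortExact (A B C : Signed) : Set (c ⊔ ℓ) where
    field
      F : Cochain A → Cochain B
      Φ : Cochain B → Cochain C
      r : Cochain B → Cochain A
      s : Cochain C → Cochain B
      F-linear : Linear F
      Φ-linear : Linear Φ
      r-linear : Linear r
      s-linear : Linear s
      F-graded : Graded A B F
      Φ-graded : Graded B C Φ
      r-graded : Graded B A r
      s-graded : Graded C B s
      F-d : ∀ f → d B (F f) ≐ F (d A f)
      Φ-d : ∀ g → d C (Φ g) ≐ Φ (d B g)
      d²≐0-B : ∀ g → d B (d B g) ≐ 0c
      B-levelled : LevelledCovers (poset B)
      r∘F : ∀ f → r (F f) ≐ f
      Φ∘s : ∀ h → Φ (s h) ≐ h
      Φ∘F : ∀ f → Φ (F f) ≐ 0c
      exact : ∀ n g → Eq C n (Φ g) 0c → Eq B n (F (r g)) g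

  module _ {A B C : Signed} (S : SplitShortExact A B C) where
    open SplitShortExact S

    F-map : CochainMap A B
    F-map = record
      { fun = λ _ → F ; resp = F-graded
      ; +-hom = λ n f g x _ → +-homo F-linear f g x
      ; ·-hom = λ n a f x _ → ·-homo F-linear a f x
      ; comm = λ n f x _ → F-d f x }

    Φ-map : CochainMap B C
    Φ-map = record
      { fun = λ _ → Φ ; resp = Φ-graded
      ; +-hom = λ n f g x _ → +-homo Φ-linear f g x
      ; ·-hom = λ n a f x _ → ·-homo Φ-linear a f x
      ; comm = λ n f x _ → Φ-d f x }

    F-injective : ∀ n f → Eq B n (F f) 0c → Eq A n f 0c
    F-injective n f Ff≈0 x lx = begin
      f x          ≈⟨ sym (r∘F f x) ⟩
      r (F f) x    ≈⟨ r-graded n Ff≈0 x lx ⟩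
      r 0c x       ≈⟨ 0-homo r-linear x ⟩
      0#           ∎

    exact-≐ : ∀ g → Φ g ≐ 0c → F (r g) ≐ g
    exact-≐ g Φg≐0 x = exact _ g (λ y _ → Φg≐0 y) x ≡.refl

    shortExact : ShortExact F-map Φ-map
    shortExact = record
      { F-inj = F-injective
      ; GF≈0 = λ n f → ≐⇒Eq {C} n (Φ∘F f)
      ; kerG⊆imF = λ n g Φg≈0 → r g , exact n g Φg≈0
      ; G-surj = λ n h → s h , ≐⇒Eq {C} n (Φ∘s h) }

    δ : ℕ → Cochain C → Cochain A
    δ _ z = r (d B (s z))

    δ-linear : Linear (δ 0)
    δ-linear = record
      { ≐-cong = λ e → ≐-cong r-linear (≐-cong dB (≐-cong s-linear e))
      ; +-homo = λ f g x → trans (≐-cong r-linear (λ y → trans (≐-cong dB (+-homo s-linear f g) y)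
                                                                 (+-homo dB _ _ y)) x)
                                 (+-homo r-linear _ _ x)
      ; ·-homo = λ a f x → trans (≐-cong r-linear (λ y → trans (≐-cong dB (·-homo s-linear a f) y)
                                                                 (·-homo dB _ _ y)) x)
                                 (·-homo r-linear _ _ x)
      }
      where
      dB : Linear (d B)
      dB = d-linear B

    Φ-d∘s : ∀ z → Φ (d B (s z)) ≐ d C z
    Φ-d∘s z x = trans (sym (Φ-d (s z) x)) (≐-cong (d-linear C) (Φ∘s z) x)

    -- δ z lifts the cocycle z to d (s z), which lies in the image of F.
    F∘δ : ∀ n z → IsCocycle C n z → Eq B (suc n) (F (δ n z)) (d B (s z))
    F∘δ n z dz≈0 = exact (suc n) (d B (s z)) (λ x lx → trans (Φ-d∘s z x) (dz≈0 x lx))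

    d-adds-coboundary : ∀ u v → d B (u -c d B v) ≐ d B u
    d-adds-coboundary u v y = begin
      d B (u -c d B v) y       ≈⟨ -‿homo (d-linear B) u _ y ⟩
      d B u y - d B (d B v) y  ≈⟨ +-congˡ (-‿cong (d²≐0-B v y)) ⟩
      d B u y - 0#             ≈⟨ x-0≈x _ ⟩
      d B u y                  ∎

    δ-cocycle : ∀ n z → IsCocycle C n z → IsCocycle A (suc n) (δ n z)
    δ-cocycle n z dz≈0 = F-injective (suc (suc n)) (d A (δ n z)) λ x lx → begin
      F (d A (δ n z)) x  ≈⟨ sym (F-d (δ n z) x) ⟩
      d B (F (δ n z)) x  ≈⟨ d-graded B B-levelled (suc n) (F∘δ n z dz≈0) x lx ⟩
      d B (d B (s z)) x  ≈⟨ d²≐0-B (s z) x ⟩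
      0#                 ∎

    δ-resp : ∀ n z w → IsCocycle C n z → IsCocycle C n w →
             Cohomologous C n z w → Cohomologous A (suc n) (δ n z) (δ n w)
    δ-resp n z w _ _ (h , z-w≈dh) = r b , λ x lx → begin
      δ n z x - δ n w x          ≈⟨ sym (-‿homo δ-linear z w x) ⟩
      r (d B (s (z -c w))) x     ≈⟨ r-graded (suc n) (d-graded B B-levelled n (s-graded n z-w≈dh)) x lx ⟩
      r (d B (s (d C h))) x      ≈⟨ ≐-cong r-linear (λ y → sym (d-adds-coboundary _ (s h) y)) x ⟩
      r (d B b) x                ≈⟨ ≐-cong r-linear (≐-cong (d-linear B) (λ y → sym (exact-≐ b Φb≐0 y))) x ⟩
      r (d B (F (r b))) x        ≈⟨ ≐-cong r-linear (F-d (r b)) x ⟩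
      r (F (d A (r b))) x        ≈⟨ r∘F _ x ⟩
      d A (r b) x                ∎
      where
      b : Cochain B
      b = s (d C h) -c d B (s h)
      Φb≐0 : Φ b ≐ 0c
      Φb≐0 y = begin
        Φ b y                                 ≈⟨ -‿homo Φ-linear _ _ y ⟩
        Φ (s (d C h)) y - Φ (d B (s h)) y     ≈⟨ +-cong (Φ∘s _ y) (-‿cong (Φ-d∘s h y)) ⟩
        d C h y - d C h y                     ≈⟨ -‿inverseʳ _ ⟩
        0#                                    ∎

    exact-A₀ : ∀ z → IsCocycle A 0 z → Cohomologous B 0 (F z) 0c → Cohomologous A 0 z 0c
    exact-A₀ z _ (h , Fz≈dh) = 0c , λ x lx → begin
      z x - 0#  ≈⟨ x-0≈x _ ⟩
      z x       ≈⟨ F-injective 0 z Fz≈0 x lx ⟩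
      0#        ≈⟨ sym (0-homo (d-linear A) x) ⟩
      d A 0c x  ∎
      where
      Fz≈0 : Eq B 0 (F z) 0c
      Fz≈0 y ly = trans (sym (x-0≈x _)) (trans (Fz≈dh y ly) (d-level0 B B-levelled h y ly))

    exact-A : ∀ n z → IsCocycle A (suc n) z →
              (Cohomologous B (suc n) (F z) 0c →
                 ∃ λ w → IsCocycle C n w × Cohomologous A (suc n) (δ n w) z)
              × ((∃ λ w → IsCocycle C n w × Cohomologous A (suc n) (δ n w) z) →
                 Cohomologous B (suc n) (F z) 0c)
    exact-A n z _ = ker⊆im , im⊆ker
      where
      ker⊆im : Cohomologous B (suc n) (F z) 0c → ∃ λ w → IsCocycle C n w × Cohomologous A (suc n) (δ n w) z
      ker⊆im (h , Fz≈dh) = Φ h , Φh-cocycle , r b , δΦh-z≈drb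
        where
        dh≈Fz : Eq B (suc n) (d B h) (F z)
        dh≈Fz x lx = sym (trans (sym (x-0≈x _)) (Fz≈dh x lx))
        Φh-cocycle : IsCocycle C n (Φ h)
        Φh-cocycle x lx = begin
          d C (Φ h) x  ≈⟨ Φ-d h x ⟩
          Φ (d B h) x  ≈⟨ Φ-graded (suc n) dh≈Fz x lx ⟩
          Φ (F z) x    ≈⟨ Φ∘F z x ⟩
          0#           ∎
        b : Cochain B
        b = s (Φ h) -c h
        sΦh≐h+Frb : s (Φ h) ≐ h +c F (r b)
        sΦh≐h+Frb y = sym (trans (+-congˡ (exact-≐ b (λ y → trans (-‿homo Φ-linear _ _ y)
                                                          (trans (+-congʳ (Φ∘s _ y)) (-‿inverseʳ _))) y))
                                 (y+[x-y]≈x _ _))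
        δΦh-z≈drb : Eq A (suc n) (δ n (Φ h) -c z) (d A (r b))
        δΦh-z≈drb x lx = begin
          δ n (Φ h) x - z x                    ≈⟨ +-congʳ δΦh≈z+drb ⟩
          (z x + d A (r b) x) - z x            ≈⟨ xyx⁻¹≈y _ _ ⟩
          d A (r b) x                          ∎
          where
          δΦh≈z+drb : δ n (Φ h) x ≈ z x + d A (r b) x
          δΦh≈z+drb = begin
            r (d B (s (Φ h))) x                ≈⟨ ≐-cong r-linear (≐-cong (d-linear B) sΦh≐h+Frb) x ⟩
            r (d B (h +c F (r b))) x           ≈⟨ ≐-cong r-linear (+-homo (d-linear B) _ _) x ⟩
            r (d B h +c d B (F (r b))) x       ≈⟨ +-homo r-linear _ _ x ⟩
            r (d B h) x + r (d B (F (r b))) x  ≈⟨ +-cong (r-graded (suc n) dh≈Fz x lx) (≐-cong r-linear (F-d (r b)) x) ⟩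
            r (F z) x + r (F (d A (r b))) x    ≈⟨ +-cong (r∘F z x) (r∘F _ x) ⟩
            z x + d A (r b) x                  ∎
      im⊆ker : (∃ λ w → IsCocycle C n w × Cohomologous A (suc n) (δ n w) z) → Cohomologous B (suc n) (F z) 0c
      im⊆ker (w , dw≈0 , k , δw-z≈dk) = s w -c F k , λ x lx → begin
        F z x - 0#                       ≈⟨ x-0≈x _ ⟩
        F z x                            ≈⟨ F-graded (suc n) (λ y ly → x-y≈z⇒y≈x-z (δw-z≈dk y ly)) x lx ⟩
        F (δ n w -c d A k) x             ≈⟨ -‿homo F-linear _ _ x ⟩
        F (δ n w) x - F (d A k) x        ≈⟨ +-cong (F∘δ n w dw≈0 x lx) (-‿cong (sym (F-d k x))) ⟩
        d B (s w) x - d B (F k) x        ≈⟨ sym (-‿homo (d-linear B) _ _ x) ⟩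
        d B (s w -c F k) x               ∎

    exact-B : ∀ n z → IsCocycle B n z →
              (Cohomologous C n (Φ z) 0c →
                 ∃ λ w → IsCocycle A n w × Cohomologous B n (F w) z)
              × ((∃ λ w → IsCocycle A n w × Cohomologous B n (F w) z) →
                 Cohomologous C n (Φ z) 0c)
    exact-B n z dz≈0 = ker⊆im , im⊆ker
      where
      ker⊆im : Cohomologous C n (Φ z) 0c → ∃ λ w → IsCocycle A n w × Cohomologous B n (F w) z
      ker⊆im (h , Φz≈dh) = r b , rb-cocycle , 0c -c s h , Frb-z≈d[-sh]
        where
        b : Cochain B
        b = z -c d B (s h)
        Frb≈b : Eq B n (F (r b)) b
        Frb≈b = exact n b λ x lx → begin
          Φ b x                             ≈⟨ -‿homo Φ-linear _ _ x ⟩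
          Φ z x - Φ (d B (s h)) x           ≈⟨ +-congˡ (-‿cong (Φ-d∘s h x)) ⟩
          Φ z x - d C h x                   ≈⟨ +-congˡ (-‿cong (sym (trans (sym (x-0≈x _)) (Φz≈dh x lx)))) ⟩
          Φ z x - Φ z x                     ≈⟨ -‿inverseʳ _ ⟩
          0#                                ∎
        rb-cocycle : IsCocycle A n (r b)
        rb-cocycle = F-injective (suc n) (d A (r b)) λ x lx → begin
          F (d A (r b)) x   ≈⟨ sym (F-d _ x) ⟩
          d B (F (r b)) x   ≈⟨ d-graded B B-levelled n Frb≈b x lx ⟩
          d B b x           ≈⟨ d-adds-coboundary z (s h) x ⟩
          d B z x           ≈⟨ dz≈0 x lx ⟩
          0#                ∎
        Frb-z≈d[-sh] : Eq B n (F (r b) -c z) (d B (0c -c s h))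
        Frb-z≈d[-sh] x lx = begin
          F (r b) x - z x                ≈⟨ +-congʳ (Frb≈b x lx) ⟩
          (z x - d B (s h) x) - z x      ≈⟨ xyx⁻¹≈y _ _ ⟩
          - d B (s h) x                  ≈⟨ sym (+-identityˡ _) ⟩
          0# - d B (s h) x               ≈⟨ +-congʳ (sym (0-homo (d-linear B) x)) ⟩
          d B 0c x - d B (s h) x         ≈⟨ sym (-‿homo (d-linear B) _ _ x) ⟩
          d B (0c -c s h) x              ∎
      im⊆ker : (∃ λ w → IsCocycle A n w × Cohomologous B n (F w) z) → Cohomologous C n (Φ z) 0c
      im⊆ker (w , _ , k , Fw-z≈dk) = 0c -c Φ k , λ x lx → begin
        Φ z x - 0#                    ≈⟨ x-0≈x _ ⟩
        Φ z x                         ≈⟨ Φ-graded n (λ y ly → x-y≈z⇒y≈x-z (Fw-z≈dk y ly)) x lx ⟩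
        Φ (F w -c d B k) x            ≈⟨ -‿homo Φ-linear _ _ x ⟩
        Φ (F w) x - Φ (d B k) x       ≈⟨ +-cong (Φ∘F w x) (-‿cong (sym (Φ-d k x))) ⟩
        0# - d C (Φ k) x              ≈⟨ +-congʳ (sym (0-homo (d-linear C) x)) ⟩
        d C 0c x - d C (Φ k) x        ≈⟨ sym (-‿homo (d-linear C) _ _ x) ⟩
        d C (0c -c Φ k) x             ∎

    exact-C : ∀ n z → IsCocycle C n z →
              (Cohomologous A (suc n) (δ n z) 0c →
                 ∃ λ w → IsCocycle B n w × Cohomologous C n (Φ w) z)
              × ((∃ λ w → IsCocycle B n w × Cohomologous C n (Φ w) z) →
                 Cohomologous A (suc n) (δ n z) 0c)
    exact-C n z dz≈0 = ker⊆im , im⊆ker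
      where
      ker⊆im : Cohomologous A (suc n) (δ n z) 0c → ∃ λ w → IsCocycle B n w × Cohomologous C n (Φ w) z
      ker⊆im (k , δz≈dk) = s z -c F k , lift-cocycle , ≐⇒Cohomologous {C} n Φ[sz-Fk]≐z
        where
        δz-dk≈0 : Eq A (suc n) (δ n z -c d A k) 0c
        δz-dk≈0 x lx = begin
          δ n z x - d A k x  ≈⟨ +-congˡ (-‿cong (sym (trans (sym (x-0≈x _)) (δz≈dk x lx)))) ⟩
          δ n z x - δ n z x  ≈⟨ -‿inverseʳ _ ⟩
          0#                 ∎
        lift-cocycle : IsCocycle B n (s z -c F k)
        lift-cocycle x lx = begin
          d B (s z -c F k) x            ≈⟨ -‿homo (d-linear B) _ _ x ⟩
          d B (s z) x - d B (F k) x     ≈⟨ +-cong (sym (F∘δ n z dz≈0 x lx)) (-‿cong (F-d k x)) ⟩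
          F (δ n z) x - F (d A k) x     ≈⟨ sym (-‿homo F-linear _ _ x) ⟩
          F (δ n z -c d A k) x          ≈⟨ F-graded (suc n) δz-dk≈0 x lx ⟩
          F 0c x                        ≈⟨ 0-homo F-linear x ⟩
          0#                            ∎
        Φ[sz-Fk]≐z : Φ (s z -c F k) ≐ z
        Φ[sz-Fk]≐z x = begin
          Φ (s z -c F k) x              ≈⟨ -‿homo Φ-linear _ _ x ⟩
          Φ (s z) x - Φ (F k) x         ≈⟨ +-cong (Φ∘s z x) (-‿cong (Φ∘F k x)) ⟩
          z x - 0#                      ≈⟨ x-0≈x _ ⟩
          z x                           ∎
      im⊆ker : (∃ λ w → IsCocycle B n w × Cohomologous C n (Φ w) z) → Cohomologous A (suc n) (δ n z) 0c
      im⊆ker (w , dw≈0 , h , Φw-z≈dh) = r b , λ x lx → begin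
        δ n z x - 0#             ≈⟨ x-0≈x _ ⟩
        r (d B (s z)) x          ≈⟨ r-graded (suc n) dsz≈Fdrb x lx ⟩
        r (F (d A (r b))) x      ≈⟨ r∘F _ x ⟩
        d A (r b) x              ∎
        where
        u b : Cochain B
        u = w -c d B (s h)
        b = s z -c u
        Frb≈b : Eq B n (F (r b)) b
        Frb≈b = exact n b λ x lx → begin
          Φ b x                                 ≈⟨ -‿homo Φ-linear _ _ x ⟩
          Φ (s z) x - Φ u x                     ≈⟨ +-cong (Φ∘s z x) (-‿cong (-‿homo Φ-linear _ _ x)) ⟩
          z x - (Φ w x - Φ (d B (s h)) x)       ≈⟨ +-congˡ (-‿cong (+-congˡ (-‿cong (Φ-d∘s h x)))) ⟩
          z x - (Φ w x - d C h x)               ≈⟨ +-congˡ (-‿cong (sym (x-y≈z⇒y≈x-z (Φw-z≈dh x lx)))) ⟩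
          z x - z x                             ≈⟨ -‿inverseʳ _ ⟩
          0#                                    ∎
        dsz≈Fdrb : Eq B (suc n) (d B (s z)) (F (d A (r b)))
        dsz≈Fdrb x lx = begin
          d B (s z) x              ≈⟨ ≐-cong (d-linear B) (λ y → sym (y+[x-y]≈x (s z y) (u y))) x ⟩
          d B (u +c b) x           ≈⟨ +-homo (d-linear B) _ _ x ⟩
          d B u x + d B b x        ≈⟨ +-congʳ (d-adds-coboundary w (s h) x) ⟩
          d B w x + d B b x        ≈⟨ +-cong (dw≈0 x lx) (sym (d-graded B B-levelled n Frb≈b x lx)) ⟩
          0# + d B (F (r b)) x     ≈⟨ +-identityˡ _ ⟩
          d B (F (r b)) x          ≈⟨ F-d _ x ⟩
          F (d A (r b)) x          ∎

    longExact : LongExact F-map Φ-map δ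
    longExact = record
      { δ-cocycle = δ-cocycle
      ; δ-resp = δ-resp
      ; δ-+ = λ n z w _ _ → ≐⇒Cohomologous {A} (suc n) (+-homo δ-linear z w)
      ; δ-· = λ n a z _ → ≐⇒Cohomologous {A} (suc n) (·-homo δ-linear a z)
      ; exact-A₀ = exact-A₀
      ; exact-A = exact-A
      ; exact-B = exact-B
      ; exact-C = exact-C
      }

module GluingSequence {c ℓ} (K : Field c ℓ) {G G₁ G₂ : Digraph}
  (i₁ : RegularMorphism G G₁) (i₂ : RegularMorphism G G₂)
  (ε∇ : SignAssignment (∇ i₁ i₂)) (ε₁ : SignAssignment (P G₁))
  (ε₂ : SignAssignment (P G₂)) (ε₀ : SignAssignment (P G)) where
  open Multipaths
  open SignTwists
  open Gluing
  open import Data.Bool using (Bool; true; false; _xor_)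
  open import Data.Bool.Properties using (xor-assoc; xor-same; xor-identityʳ)
  open import Data.List.Properties using (map-∘)
  open import Data.List.Membership.Propositional.Properties using (∈-map⁺; ∈-map⁻)
  open import Data.List.Relation.Binary.Permutation.Propositional using (↭-refl; ↭-sym; ↭-trans; ↭-reflexive)
  import Data.List.Relation.Binary.Permutation.Propositional.Properties as ↭
  open import Data.Product using (∃; proj₁; proj₂)
  open import Data.Sum using (inj₁; inj₂)
  open import Data.Empty using (⊥-elim)
  open import Data.Unit using (⊤; tt)
  open import Function using (_∘_)
  open import Relation.Nullary using (Dec; yes; no)
  import Relation.Binary.PropositionalEquality as ≡
  open ≡ using (_≡_)
  import Algebra.Properties.AbelianGroup as AbelianGroupProperties
  import Algebra.Properties.CommutativeSemigroup as CommutativeSemigroupProperties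
  import Relation.Binary.Reasoning.Setoid as SetoidReasoning
  open Field K
  open Cochains K
  open CochainAlgebra K
  open SplitExact K
  open AbelianGroupProperties +-abelianGroup using (x∙y⁻¹≈ε⇒x≈y)
  open SetoidReasoning setoid

  A X₁ X₂ B C : Signed
  A = signed (∇ i₁ i₂) ε∇
  X₁ = signed (P G₁) ε₁
  X₂ = signed (P G₂) ε₂
  B = X₁ ⊕ X₂
  C = signed (P G) ε₀

  private
    ι₁ : Multipath G → Multipath G₁
    ι₁ = ι i₁
    ι₂ : Multipath G → Multipath G₂
    ι₂ = ι i₂
    cl : Multipath G₂ → Elt∇ i₁ i₂
    cl = class₂ i₁ i₂

  σ₁-twist : ∃ (Twist (P G₁) (sign ε₁) (λ a x → sign ε∇ (left a) (left x)))
  σ₁-twist = twist-exists ε₁ (∇ i₁ i₂) ε∇ left (left-injective i₁ i₂) (∈-map⁺ left)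

  σ₂-twist : ∃ (Twist (P G₂) (sign ε₂) (λ a z → sign ε∇ (cl a) (cl z)))
  σ₂-twist = twist-exists ε₂ (∇ i₁ i₂) ε∇ cl (class₂-injective i₁ i₂)
    (λ {a} {z} a≺z → ↭.∈-resp-↭ (↭-sym (preds∇-class₂ i₁ i₂ z)) (∈-map⁺ cl a≺z))

  τ₁-twist : ∃ (Twist (P G) (sign ε₀) (λ a y → sign ε₁ (ι₁ a) (ι₁ y)))
  τ₁-twist = twist-exists ε₀ (P G₁) ε₁ ι₁ (ι-injective i₁) (λ {a} {y} → ι-covers i₁ {a} {y})

  σ₁ : Multipath G₁ → Bool
  σ₁ = proj₁ σ₁-twist
  σ₂ : Multipath G₂ → Bool
  σ₂ = proj₁ σ₂-twist
  τ₁ : Multipath G → Bool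
  τ₁ = proj₁ τ₁-twist

  -- The twist along ι₂ is forced by requiring Φ ∘ F = 0.
  τ₂ : Multipath G → Bool
  τ₂ y = (τ₁ y xor σ₁ (ι₁ y)) xor σ₂ (ι₂ y)

  private
    σ₁∘ι₁-twist : Twist (P G) (λ a y → sign ε₁ (ι₁ a) (ι₁ y)) (λ a y → sign ε∇ (left (ι₁ a)) (left (ι₁ y))) (σ₁ ∘ ι₁)
    σ₁∘ι₁-twist = twist-comap ι₁ (λ {a} {y} → ι-covers i₁ {a} {y}) {g = σ₁} (proj₂ σ₁-twist)

    σ₂∘ι₂-twist : Twist (P G) (λ a y → sign ε₂ (ι₂ a) (ι₂ y)) (λ a y → sign ε∇ (left (ι₁ a)) (left (ι₁ y))) (σ₂ ∘ ι₂)
    σ₂∘ι₂-twist = twist-resp (λ {a} {y} _ → ≡.cong₂ (sign ε∇) (class₂-ι i₁ i₂ a) (class₂-ι i₁ i₂ y))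
                             (twist-comap ι₂ (λ {a} {y} → ι-covers i₂ {a} {y}) {g = σ₂} (proj₂ σ₂-twist))

  τ₂-twist : Twist (P G) (sign ε₀) (λ a y → sign ε₂ (ι₂ a) (ι₂ y)) τ₂
  τ₂-twist = twist-trans {g = λ y → τ₁ y xor σ₁ (ι₁ y)} {h = σ₂ ∘ ι₂}
               (twist-trans {g = τ₁} {h = σ₁ ∘ ι₁} (proj₂ τ₁-twist) σ₁∘ι₁-twist)
               (twist-sym σ₂∘ι₂-twist)

  left-map : TwistedCoverMap A X₁
  left-map = record
    { mapElt = left ; twist = σ₁ ; preds-↭ = λ _ → ↭-refl ; level-≡ = λ _ → ≡.refl
    ; sign-twist = proj₂ σ₁-twist }

  class₂-map : TwistedCoverMap A X₂
  class₂-map = record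
    { mapElt = cl ; twist = σ₂ ; preds-↭ = preds∇-class₂ i₁ i₂ ; level-≡ = level∇-class₂ i₁ i₂
    ; sign-twist = proj₂ σ₂-twist }

  ι₁-map : TwistedCoverMap B C
  ι₁-map = record
    { mapElt = inj₁ ∘ ι₁ ; twist = τ₁ ; level-≡ = #edges-ι i₁ ; sign-twist = proj₂ τ₁-twist
    ; preds-↭ = λ y → ↭-trans (↭.map⁺ inj₁ (predsP-ι i₁ y)) (↭-reflexive (≡.sym (map-∘ (predsP y)))) }

  ι₂-map : TwistedCoverMap B C
  ι₂-map = record
    { mapElt = inj₂ ∘ ι₂ ; twist = τ₂ ; level-≡ = #edges-ι i₂ ; sign-twist = τ₂-twist
    ; preds-↭ = λ y → ↭-trans (↭.map⁺ inj₂ (predsP-ι i₂ y)) (↭-reflexive (≡.sym (map-∘ (predsP y)))) }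

  F : Cochain A → Cochain B
  F f (inj₁ x) = pullback left-map f x
  F f (inj₂ z) = pullback class₂-map f z

  Φ : Cochain B → Cochain C
  Φ g = pullback ι₁-map g -c pullback ι₂-map g

  r : Cochain B → Cochain A
  r g (left x)    = sgn (σ₁ x) * g (inj₁ x)
  r g (right z _) = sgn (σ₂ z) * g (inj₂ z)

  liftAlong-ι₁ : Cochain C → (x : Multipath G₁) → Dec (InImage i₁ x) → Carrier
  liftAlong-ι₁ h x (yes (y , _)) = sgn (τ₁ y) * h y
  liftAlong-ι₁ h x (no _)        = 0#

  s : Cochain C → Cochain B
  s h (inj₁ x) = liftAlong-ι₁ h x (inImage? i₁ x)
  s h (inj₂ _) = 0#

  liftAlong-ι₁-ι : ∀ h y (dec : Dec (InImage i₁ (ι₁ y))) → liftAlong-ι₁ h (ι₁ y) dec ≈ sgn (τ₁ y) * h y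
  liftAlong-ι₁-ι h y (yes (y′ , ι₁y′≡ι₁y)) with ≡.refl ← ι-injective i₁ {y′} {y} ι₁y′≡ι₁y = refl
  liftAlong-ι₁-ι h y (no ∉image) = ⊥-elim (∉image (y , ≡.refl))

  open CommutativeSemigroupProperties *-commutativeSemigroup using (x∙yz≈y∙xz)

  F-linear : Linear F
  F-linear = record
    { ≐-cong = λ { f≐g (inj₁ x) → ≐-cong (pullback-linear left-map) f≐g x
                 ; f≐g (inj₂ z) → ≐-cong (pullback-linear class₂-map) f≐g z }
    ; +-homo = λ { f g (inj₁ x) → distribˡ _ _ _ ; f g (inj₂ z) → distribˡ _ _ _ }
    ; ·-homo = λ { a f (inj₁ x) → x∙yz≈y∙xz _ a _ ; a f (inj₂ z) → x∙yz≈y∙xz _ a _ }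
    }

  Φ-linear : Linear Φ
  Φ-linear = -‿linear (pullback-linear ι₁-map) (pullback-linear ι₂-map)

  r-linear : Linear r
  r-linear = record
    { ≐-cong = λ { f≐g (left x) → *-congˡ (f≐g _) ; f≐g (right z _) → *-congˡ (f≐g _) }
    ; +-homo = λ { f g (left x) → distribˡ _ _ _ ; f g (right z _) → distribˡ _ _ _ }
    ; ·-homo = λ { a f (left x) → x∙yz≈y∙xz _ a _ ; a f (right z _) → x∙yz≈y∙xz _ a _ }
    }

  liftAlong-ι₁-linear : ∀ x (dec : Dec (InImage i₁ x)) → Linear {E′ = ⊤} (λ h _ → liftAlong-ι₁ h x dec)
  liftAlong-ι₁-linear x (yes (y , _)) = record
    { ≐-cong = λ f≐g _ → *-congˡ (f≐g y)
    ; +-homo = λ f g _ → distribˡ _ _ _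
    ; ·-homo = λ a f _ → x∙yz≈y∙xz _ a _
    }
  liftAlong-ι₁-linear x (no _) = record
    { ≐-cong = λ _ _ → refl
    ; +-homo = λ _ _ _ → sym (+-identityˡ 0#)
    ; ·-homo = λ a _ _ → sym (zeroʳ a)
    }

  s-linear : Linear s
  s-linear = record
    { ≐-cong = λ { f≐g (inj₁ x) → ≐-cong (lift x) f≐g tt ; f≐g (inj₂ z) → refl }
    ; +-homo = λ { f g (inj₁ x) → +-homo (lift x) f g tt ; f g (inj₂ z) → sym (+-identityˡ 0#) }
    ; ·-homo = λ { a f (inj₁ x) → ·-homo (lift x) a f tt ; a f (inj₂ z) → sym (zeroʳ a) }
    }
    where
    lift : ∀ x → Linear {E′ = ⊤} (λ h _ → liftAlong-ι₁ h x (inImage? i₁ x))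
    lift x = liftAlong-ι₁-linear x (inImage? i₁ x)

  F-graded : Graded A B F
  F-graded n f≈g (inj₁ x) = pullback-graded left-map n f≈g x
  F-graded n f≈g (inj₂ z) = pullback-graded class₂-map n f≈g z

  Φ-graded : Graded B C Φ
  Φ-graded n f≈g y ly = +-cong (pullback-graded ι₁-map n f≈g y ly) (-‿cong (pullback-graded ι₂-map n f≈g y ly))

  r-graded : Graded B A r
  r-graded n f≈g (left x)    lx = *-congˡ (f≈g (inj₁ x) lx)
  r-graded n f≈g (right z _) lz = *-congˡ (f≈g (inj₂ z) lz)

  s-graded : Graded C B s
  s-graded n {f} {g} f≈g (inj₁ x) = lift-graded (inImage? i₁ x)
    where
    lift-graded : (dec : Dec (InImage i₁ x)) → #edges (edges x) ≡ n → liftAlong-ι₁ f x dec ≈ liftAlong-ι₁ g x dec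
    lift-graded (yes (y , ≡.refl)) lx = *-congˡ (f≈g y (≡.trans (≡.sym (#edges-ι i₁ y)) lx))
    lift-graded (no _) _ = refl
  s-graded n f≈g (inj₂ z) _ = refl

  F-d : ∀ f → d B (F f) ≐ F (d A f)
  F-d f (inj₁ x) = trans (reflexive (d-⊕-inj₁ X₁ X₂ (F f) x)) (pullback-d left-map f x)
  F-d f (inj₂ z) = trans (reflexive (d-⊕-inj₂ X₁ X₂ (F f) z)) (pullback-d class₂-map f z)

  Φ-d : ∀ g → d C (Φ g) ≐ Φ (d B g)
  Φ-d g y = trans (-‿homo (d-linear C) (pullback ι₁-map g) (pullback ι₂-map g) y)
                  (+-cong (pullback-d ι₁-map g y) (-‿cong (pullback-d ι₂-map g y)))

  d²≐0-B : ∀ g → d B (d B g) ≐ 0c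
  d²≐0-B g (inj₁ x) = begin
    d B (d B g) (inj₁ x)              ≡⟨ d-⊕-inj₁ X₁ X₂ (d B g) x ⟩
    d X₁ (d B g ∘ inj₁) x             ≈⟨ ≐-cong (d-linear X₁) (λ a → reflexive (d-⊕-inj₁ X₁ X₂ g a)) x ⟩
    d X₁ (d X₁ (g ∘ inj₁)) x          ≈⟨ d²≐0 ε₁ (g ∘ inj₁) x ⟩
    0#                                ∎
  d²≐0-B g (inj₂ z) = begin
    d B (d B g) (inj₂ z)              ≡⟨ d-⊕-inj₂ X₁ X₂ (d B g) z ⟩
    d X₂ (d B g ∘ inj₂) z             ≈⟨ ≐-cong (d-linear X₂) (λ a → reflexive (d-⊕-inj₂ X₁ X₂ g a)) z ⟩
    d X₂ (d X₂ (g ∘ inj₂)) z          ≈⟨ d²≐0 ε₂ (g ∘ inj₂) z ⟩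
    0#                                ∎

  B-levelled : LevelledCovers (poset B)
  B-levelled {a} {inj₁ x} a≺x with ∈-map⁻ inj₁ {xs = predsP x} a≺x
  ... | a′ , a′≺x , ≡.refl = #edges-predsP x a′≺x
  B-levelled {a} {inj₂ z} a≺z with ∈-map⁻ inj₂ {xs = predsP z} a≺z
  ... | a′ , a′≺z , ≡.refl = #edges-predsP z a′≺z

  r∘F : ∀ f → r (F f) ≐ f
  r∘F f (left x) = sgn-sgn (σ₁ x) (f (left x))
  r∘F f (right z ∉image) = trans (*-congˡ (*-congˡ (reflexive (≡.cong f (class₂-outside i₁ i₂ z ∉image)))))
                                 (sgn-sgn (σ₂ z) (f (right z ∉image)))

  Φ∘s : ∀ h → Φ (s h) ≐ h
  Φ∘s h y = begin
    sgn (τ₁ y) * liftAlong-ι₁ h (ι₁ y) (inImage? i₁ (ι₁ y)) - sgn (τ₂ y) * 0#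
      ≈⟨ +-cong (*-congˡ (liftAlong-ι₁-ι h y (inImage? i₁ (ι₁ y)))) (-‿cong (zeroʳ _)) ⟩
    sgn (τ₁ y) * (sgn (τ₁ y) * h y) - 0#   ≈⟨ x-0≈x _ ⟩
    sgn (τ₁ y) * (sgn (τ₁ y) * h y)        ≈⟨ sgn-sgn (τ₁ y) (h y) ⟩
    h y                                    ∎

  τ₂-balances : ∀ y → τ₂ y xor σ₂ (ι₂ y) ≡ τ₁ y xor σ₁ (ι₁ y)
  τ₂-balances y = ≡.trans (xor-assoc (τ₁ y xor σ₁ (ι₁ y)) (σ₂ (ι₂ y)) (σ₂ (ι₂ y)))
                          (≡.trans (≡.cong ((τ₁ y xor σ₁ (ι₁ y)) xor_) (xor-same (σ₂ (ι₂ y))))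
                                   (xor-identityʳ (τ₁ y xor σ₁ (ι₁ y))))

  Φ∘F : ∀ f → Φ (F f) ≐ 0c
  Φ∘F f y = begin
    sgn (τ₁ y) * (sgn (σ₁ (ι₁ y)) * w) - sgn (τ₂ y) * (sgn (σ₂ (ι₂ y)) * f (cl (ι₂ y)))
      ≈⟨ +-congˡ (-‿cong (*-congˡ (*-congˡ (reflexive (≡.cong f (class₂-ι i₁ i₂ y)))))) ⟩
    sgn (τ₁ y) * (sgn (σ₁ (ι₁ y)) * w) - sgn (τ₂ y) * (sgn (σ₂ (ι₂ y)) * w)
      ≈⟨ +-congˡ (-‿cong (sgn-swap {τ₂ y} {σ₂ (ι₂ y)} {τ₁ y} {σ₁ (ι₁ y)} w (τ₂-balances y))) ⟩
    sgn (τ₁ y) * (sgn (σ₁ (ι₁ y)) * w) - sgn (τ₁ y) * (sgn (σ₁ (ι₁ y)) * w)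
      ≈⟨ -‿inverseʳ _ ⟩
    0# ∎
    where
    w : Carrier
    w = f (left (ι₁ y))

  exact : ∀ n g → Eq C n (Φ g) 0c → Eq B n (F (r g)) g
  exact n g Φg≈0 (inj₁ x) _ = sgn-sgn (σ₁ x) (g (inj₁ x))
  exact n g Φg≈0 (inj₂ z) = by-image (inImage? i₂ z)
    where
    by-image : Dec (InImage i₂ z) → #edges (edges z) ≡ n → F (r g) (inj₂ z) ≈ g (inj₂ z)
    by-image (no ∉image) _ = trans (*-congˡ (reflexive (≡.cong (r g) (class₂-outside i₁ i₂ z ∉image))))
                                   (sgn-sgn (σ₂ z) (g (inj₂ z)))
    by-image (yes (y , ≡.refl)) lz = begin
      sgn (σ₂ (ι₂ y)) * r g (cl (ι₂ y))              ≈⟨ *-congˡ (reflexive (≡.cong (r g) (class₂-ι i₁ i₂ y))) ⟩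
      sgn (σ₂ (ι₂ y)) * (sgn (σ₁ (ι₁ y)) * g₁)
        ≈⟨ sgn-swap {σ₂ (ι₂ y)} {σ₁ (ι₁ y)} {τ₂ y} {τ₁ y} g₁ (swap-table (τ₁ y) (σ₁ (ι₁ y)) (σ₂ (ι₂ y))) ⟩
      sgn (τ₂ y) * (sgn (τ₁ y) * g₁)                ≈⟨ *-congˡ (sym τ₂g₂≈τ₁g₁) ⟩
      sgn (τ₂ y) * (sgn (τ₂ y) * g₂)                ≈⟨ sgn-sgn (τ₂ y) g₂ ⟩
      g₂                                            ∎
      where
      g₁ g₂ : Carrier
      g₁ = g (inj₁ (ι₁ y))
      g₂ = g (inj₂ (ι₂ y))
      τ₂g₂≈τ₁g₁ : sgn (τ₂ y) * g₂ ≈ sgn (τ₁ y) * g₁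
      τ₂g₂≈τ₁g₁ = sym (x∙y⁻¹≈ε⇒x≈y _ _ (Φg≈0 y (≡.trans (≡.sym (#edges-ι i₂ y)) lz)))
      swap-table : ∀ t u v → v xor u ≡ ((t xor u) xor v) xor t
      swap-table false false false = ≡.refl
      swap-table false false true  = ≡.refl
      swap-table false true  false = ≡.refl
      swap-table false true  true  = ≡.refl
      swap-table true  false false = ≡.refl
      swap-table true  false true  = ≡.refl
      swap-table true  true  false = ≡.refl
      swap-table true  true  true  = ≡.refl

  splitShortExact : SplitShortExact A B C
  splitShortExact = record
    { F = F ; Φ = Φ ; r = r ; s = s
    ; F-linear = F-linear ; Φ-linear = Φ-linear ; r-linear = r-linear ; s-linear = s-linear
    ; F-graded = F-graded ; Φ-graded = Φ-graded ; r-graded = r-graded ; s-graded = s-graded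
    ; F-d = F-d ; Φ-d = Φ-d ; d²≐0-B = d²≐0-B ; B-levelled = λ {a} {y} → B-levelled {a} {y}
    ; r∘F = r∘F ; Φ∘s = Φ∘s ; Φ∘F = Φ∘F ; exact = exact
    }

theorem4p4 : ∀ {c ℓ} (K : Field c ℓ) (G G₁ G₂ : Digraph)
               (i₁ : RegularMorphism G G₁) (i₂ : RegularMorphism G G₂)
               (ε∇ : SignAssignment (∇ i₁ i₂))
               (ε₁ : SignAssignment (P G₁)) (ε₂ : SignAssignment (P G₂))
               (ε : SignAssignment (P G)) →
               let open Cochains K
                   A = signed (∇ i₁ i₂) ε∇
                   B = signed (P G₁) ε₁ ⊕ signed (P G₂) ε₂
                   C = signed (P G) ε
               in Σ (CochainMap A B) λ F → Σ (CochainMap B C) λ Φ →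
                    ShortExact F Φ × Σ (ℕ → Cochain C → Cochain A) (LongExact F Φ)
theorem4p4 K G G₁ G₂ i₁ i₂ ε∇ ε₁ ε₂ ε = F-map S , Φ-map S , shortExact S , δ S , longExact S
  where
  open SplitExact K
  S : SplitShortExact (signed (∇ i₁ i₂) ε∇) (signed (P G₁) ε₁ ⊕ signed (P G₂) ε₂) (signed (P G) ε)
  S = GluingSequence.splitShortExact K i₁ i₂ ε∇ ε₁ ε₂ ε
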